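{- Let $\Lambda$ be any subset of the following six frame conditions, each paired with an axiom schema (here $w,v$ range over worlds, $s,t$ over sets of worlds, $wR_\Sigma v$ means $v\in\bigcup\Sigma(w)$, $\varphi,\psi$ range over arbitrary formulas and $\alpha$ over declaratives): (1) downward-monotonicity: $\emptyset\neq t\subseteq s\in\Sigma(w)\Rightarrow t\in\Sigma(w)$; axiom $(\varphi\Rrightarrow\psi)\to\boxplus(\varphi\to\psi)$; (2) finite union-closure: $s,t\in\Sigma(w)\Rightarrow s\cup t\in\Sigma(w)$; axiom $(\alpha\Rrightarrow\varphi\veebar\psi)\to(\alpha\Rrightarrow\varphi)\vee(\alpha\Rrightarrow\psi)$; (3) reflexivity: $w\in\bigcup\Sigma(w)$; axiom $\boxplus\alpha\to\alpha$; (4) non-triviality: $\Sigma(w)\neq\emptyset$; axiom $\neg\boxplus\bot$; (5) decreasingness: $wR_\Sigma v\Rightarrow\Sigma(w)\supseteq\Sigma(v)$; axiom $(\varphi\Rrightarrow\psi)\to\boxplus(\varphi\Rrightarrow\psi)$; (6) increasingness: $wR_\Sigma v\Rightarrow\Sigma(w)\subseteq\Sigma(v)$; axiom $\neg(\varphi\Rrightarrow\psi)\to\boxplus\neg(\varphi\Rrightarrow\psi)$. Let $\vdash_\Lambda$ be derivability in the proof system obtained by adding, as axioms, all instances of the schemata corresponding to the conditions in $\Lambda$, and let $\models_\Lambda$ be consequence over the class of in-models whose underlying frame $\langle W,\Sigma\rangle$ satisfies all conditions in $\Lambda$. Then for all $\Phi\cup\{\psi\}\subseteq\mathcal L_{\Rrightarrow}$: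 $\Phi\vdash_\Lambda\psi$ if and only if $\Phi\models_\Lambda\psi$.
   Context: Fix a set $\mathcal P$ of atoms. Formulas of $\mathcal L_{\Rrightarrow}$: $\varphi ::= p \mid \bot \mid (\varphi\wedge\varphi)\mid(\varphi\to\varphi)\mid(\varphi\veebar\varphi)\mid(\varphi\Rrightarrow\varphi)$, $p\in\mathcal P$, with $\veebar$ inquisitive disjunction; $\neg\varphi:=\varphi\to\bot$, $\top:=\neg\bot$, $\varphi\vee\psi:=\neg(\neg\varphi\wedge\neg\psi)$, $\boxplus\varphi:=(\top\Rrightarrow\varphi)$. A declarative is a formula in which every occurrence of $\veebar$ lies within an argument of some occurrence of $\Rrightarrow$. An in-model is $M=\langle W,\Sigma,V\rangle$ with $W$ nonempty, $\Sigma(w)$ a set of nonempty subsets of $W$ for each $w\in W$, $V:W\times\mathcal P\to\{0,1\}$; its frame is $\langle W,\Sigma\rangle$. Support at $s\subseteq W$: $M,s\models p$ iff $V(w,p)=1$ for all $w\in s$; $M,s\models\bot$ iff $s=\emptyset$; $\wedge$ conjunctively; $M,s\models\varphi\veebar\psi$ iff $M,s\models\varphi$ or $M,s\models\psi$; $M,s\models\varphi\to\psi$ iff for all $t\subseteq s$, $M,t\models\varphi$ implies $M,t\models\psi$; $M,s\models\varphi\Rrightarrow\psi$ iff for all $w\in s$ and $t\in\Sigma(w)$, $M,t\models\varphi$ implies $M,t\models\psi$. For a class of in-models, $\Phi\models\psi$ over the class means: for every in-model $M$ in the class and state $s$, if $M,s\models\varphi$ for all $\varphi\in\Phi$ then $M,s\models\psi$.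 Base proof system: axioms are all instances of the axioms of intuitionistic propositional logic with $\veebar$ as disjunction; (DDN) $\neg\neg\alpha\to\alpha$ and (Split) $(\alpha\to\varphi\veebar\psi)\to(\alpha\to\varphi)\veebar(\alpha\to\psi)$ for $\alpha$ declarative; (Trans) $(\varphi\Rrightarrow\psi)\wedge(\psi\Rrightarrow\chi)\to(\varphi\Rrightarrow\chi)$; (RConj) $(\varphi\Rrightarrow\psi)\wedge(\varphi\Rrightarrow\chi)\to(\varphi\Rrightarrow\psi\wedge\chi)$; (LDisj) $(\varphi\Rrightarrow\chi)\wedge(\psi\Rrightarrow\chi)\to(\varphi\veebar\psi\Rrightarrow\chi)$. Rules: modus ponens and conditional necessitation (from $\varphi\to\psi$ infer $\varphi\Rrightarrow\psi$). $\Phi\vdash\psi$ means some finite $\varphi_1,\dots,\varphi_n\in\Phi$ ($n\ge0$) have $(\varphi_1\wedge\dots\wedge\varphi_n)\to\psi$ derivable. -}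

module Defs where

open import Level using (Level; _⊔_; Lift; lift; Setω) renaming (suc to lsuc; zero to lzero)
open import Data.Bool using (Bool; true; false)
open import Data.Product using (Σ; ∃; _×_; _,_)
open import Data.Sum using (_⊎_)
open import Data.Empty using (⊥)
open import Data.List using (List; []; _∷_)
open import Data.List.Relation.Unary.All using (All)
open import Relation.Nullary using (¬_)
open import Relation.Binary.PropositionalEquality using (_≡_)

infixr 6 _∧_
infixr 5 _⩒_
infixr 4 _⇒_
infixr 3 _⇛_

data Form (P : Set) : Set where
  atom : P → Form P
  ⊥f   : Form P
  _∧_  : Form P → Form P → Form P
  _⇒_  : Form P → Form P → Form P
  _⩒_  : Form P → Form P → Form P
  _⇛_  : Form P → Form P → Form P

module _ {P : Set} where

  ¬f_ : Form P → Form P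
  ¬f φ = φ ⇒ ⊥f

  ⊤f : Form P
  ⊤f = ¬f ⊥f

  _∨f_ : Form P → Form P → Form P
  φ ∨f ψ = ¬f ((¬f φ) ∧ (¬f ψ))

  ⊞ : Form P → Form P
  ⊞ φ = ⊤f ⇛ φ

data Declarative {P : Set} : Form P → Set where
  d-atom : ∀ p → Declarative (atom p)
  d-⊥    : Declarative ⊥f
  d-∧    : ∀ {φ ψ} → Declarative φ → Declarative ψ → Declarative (φ ∧ ψ)
  d-⇒    : ∀ {φ ψ} → Declarative φ → Declarative ψ → Declarative (φ ⇒ ψ)
  d-⇛    : ∀ φ ψ → Declarative (φ ⇛ ψ)

data Cond : Set where
  downMono unionClosed reflexive nonTrivial decreasing increasing : Cond

CondSet : Set
CondSet = Cond → Bool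

data CondAxiom {P : Set} : Cond → Form P → Set where
  ax-downMono    : ∀ φ ψ → CondAxiom downMono ((φ ⇛ ψ) ⇒ ⊞ (φ ⇒ ψ))
  ax-unionClosed : ∀ α φ ψ → Declarative α →
                   CondAxiom unionClosed ((α ⇛ (φ ⩒ ψ)) ⇒ ((α ⇛ φ) ∨f (α ⇛ ψ)))
  ax-reflexive   : ∀ α → Declarative α → CondAxiom reflexive (⊞ α ⇒ α)
  ax-nonTrivial  : CondAxiom nonTrivial (¬f (⊞ ⊥f))
  ax-decreasing  : ∀ φ ψ → CondAxiom decreasing ((φ ⇛ ψ) ⇒ ⊞ (φ ⇛ ψ))
  ax-increasing  : ∀ φ ψ → CondAxiom increasing ((¬f (φ ⇛ ψ)) ⇒ ⊞ (¬f (φ ⇛ ψ)))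

data Derivable {P : Set} (Λ : CondSet) : Form P → Set where
  ax-K     : ∀ φ ψ → Derivable Λ (φ ⇒ (ψ ⇒ φ))
  ax-S     : ∀ φ ψ χ → Derivable Λ ((φ ⇒ (ψ ⇒ χ)) ⇒ ((φ ⇒ ψ) ⇒ (φ ⇒ χ)))
  ax-∧E₁   : ∀ φ ψ → Derivable Λ ((φ ∧ ψ) ⇒ φ)
  ax-∧E₂   : ∀ φ ψ → Derivable Λ ((φ ∧ ψ) ⇒ ψ)
  ax-∧I    : ∀ φ ψ → Derivable Λ (φ ⇒ (ψ ⇒ (φ ∧ ψ)))
  ax-⩒I₁   : ∀ φ ψ → Derivable Λ (φ ⇒ (φ ⩒ ψ))
  ax-⩒I₂   : ∀ φ ψ → Derivable Λ (ψ ⇒ (φ ⩒ ψ))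
  ax-⩒E    : ∀ φ ψ χ → Derivable Λ ((φ ⇒ χ) ⇒ ((ψ ⇒ χ) ⇒ ((φ ⩒ ψ) ⇒ χ)))
  ax-EFQ   : ∀ φ → Derivable Λ (⊥f ⇒ φ)
  ax-DDN   : ∀ α → Declarative α → Derivable Λ ((¬f (¬f α)) ⇒ α)
  ax-Split : ∀ α φ ψ → Declarative α →
             Derivable Λ ((α ⇒ (φ ⩒ ψ)) ⇒ ((α ⇒ φ) ⩒ (α ⇒ ψ)))
  ax-Trans : ∀ φ ψ χ → Derivable Λ (((φ ⇛ ψ) ∧ (ψ ⇛ χ)) ⇒ (φ ⇛ χ))
  ax-RConj : ∀ φ ψ χ → Derivable Λ (((φ ⇛ ψ) ∧ (φ ⇛ χ)) ⇒ (φ ⇛ (ψ ∧ χ)))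
  ax-LDisj : ∀ φ ψ χ → Derivable Λ (((φ ⇛ χ) ∧ (ψ ⇛ χ)) ⇒ ((φ ⩒ ψ) ⇛ χ))
  ax-Λ     : ∀ c φ → Λ c ≡ true → CondAxiom c φ → Derivable Λ φ
  mp       : ∀ {φ ψ} → Derivable Λ (φ ⇒ ψ) → Derivable Λ φ → Derivable Λ ψ
  cn       : ∀ {φ ψ} → Derivable Λ (φ ⇒ ψ) → Derivable Λ (φ ⇛ ψ)

conj : {P : Set} → Form P → List (Form P) → Form P
conj φ []       = φ
conj φ (χ ∷ χs) = φ ∧ conj χ χs

DerivFrom : {P : Set} → CondSet → List (Form P) → Form P → Set
DerivFrom Λ []       ψ = Derivable Λ ψ
DerivFrom Λ (φ ∷ φs) ψ = Derivable Λ (conj φ φs ⇒ ψ)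

_⊢[_]_ : {P : Set} → (Form P → Set) → CondSet → Form P → Set
Φ ⊢[ Λ ] ψ = ∃ λ φs → All Φ φs × DerivFrom Λ φs ψ

Pred : ∀ {ℓ} → Set ℓ → Set (lsuc ℓ)
Pred {ℓ} W = W → Set ℓ

_⊆_ : ∀ {ℓ} {W : Set ℓ} → Pred W → Pred W → Set ℓ
s ⊆ t = ∀ x → s x → t x

_∪_ : ∀ {ℓ} {W : Set ℓ} → Pred W → Pred W → Pred W
(s ∪ t) x = s x ⊎ t x

Nonempty : ∀ {ℓ} {W : Set ℓ} → Pred W → Set ℓ
Nonempty s = ∃ λ x → s x

record InModel (P : Set) (ℓ : Level) : Set (lsuc ℓ) where
  field
    W        : Set ℓ
    world    : W                                -- W is nonempty
    Sg       : W → Pred W → Set ℓ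
    Sg-ne    : ∀ w t → Sg w t → Nonempty t
    Sg-ext   : ∀ w t t' → t ⊆ t' → t' ⊆ t → Sg w t → Sg w t'  -- Σ(w) is a set of sets (extensional)
    V        : W → P → Bool

module _ {P : Set} {ℓ : Level} (M : InModel P ℓ) where
  open InModel M

  R : W → W → Set (lsuc ℓ)
  R w v = ∃ λ t → Sg w t × t v

  FrameCond : Cond → Set (lsuc ℓ)
  FrameCond downMono    = ∀ w s t → Nonempty t → t ⊆ s → Sg w s → Sg w t
  FrameCond unionClosed = ∀ w s t → Sg w s → Sg w t → Sg w (s ∪ t)
  FrameCond reflexive   = ∀ w → R w w
  FrameCond nonTrivial  = ∀ w → ∃ λ t → Sg w t
  FrameCond decreasing  = ∀ w v → R w v → ∀ t → Sg v t → Sg w t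
  FrameCond increasing  = ∀ w v → R w v → ∀ t → Sg w t → Sg v t

  _⊨_ : Pred W → Form P → Set (lsuc ℓ)
  s ⊨ atom p  = Lift (lsuc ℓ) (∀ w → s w → V w p ≡ true)
  s ⊨ ⊥f      = Lift (lsuc ℓ) (∀ w → ¬ s w)
  s ⊨ (φ ∧ ψ) = (s ⊨ φ) × (s ⊨ ψ)
  s ⊨ (φ ⩒ ψ) = (s ⊨ φ) ⊎ (s ⊨ ψ)
  s ⊨ (φ ⇒ ψ) = ∀ t → t ⊆ s → t ⊨ φ → t ⊨ ψ
  s ⊨ (φ ⇛ ψ) = ∀ w → s w → ∀ t → Sg w t → t ⊨ φ → t ⊨ ψ

FrameSat : {P : Set} {ℓ : Level} → CondSet → InModel P ℓ → Set (lsuc ℓ)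
FrameSat Λ M = ∀ c → Λ c ≡ true → FrameCond M c

_⊨[_,_]_ : {P : Set} → (Form P → Set) → CondSet → (ℓ : Level) → Form P → Set (lsuc ℓ)
Φ ⊨[ Λ , ℓ ] ψ =
  (M : InModel _ ℓ) → FrameSat Λ M →
  (s : Pred (InModel.W M)) → (∀ φ → Φ φ → _⊨_ M s φ) → _⊨_ M s ψ

Consequence : {P : Set} → (Form P → Set) → CondSet → Form P → Setω
Consequence Φ Λ ψ = ∀ ℓ → Φ ⊨[ Λ , ℓ ] ψ

-- Classical metatheory (ZFC-style) as explicit hypotheses

ExcludedMiddleω : Setω
ExcludedMiddleω = ∀ {ℓ} {A : Set ℓ} → A ⊎ ¬ A

Zorn : (ℓ : Level) → Set (lsuc ℓ)
Zorn ℓ = (A : Set ℓ) (_≤_ : A → A → Set ℓ) →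
  (∀ {a} → a ≤ a) → (∀ {a b c} → a ≤ b → b ≤ c → a ≤ c) →
  ((C : A → Set ℓ) → (∀ a b → C a → C b → (a ≤ b) ⊎ (b ≤ a)) →
     ∃ λ u → ∀ a → C a → a ≤ u) →
  ∃ λ m → ∀ a → m ≤ a → a ≤ m

Zornω : Setω
Zornω = ∀ {ℓ} → Zorn ℓ

record _⇔ω_ (A : Set) (B : Setω) : Setω where
  field
    to   : A → B
    from : B → A

-- Soundness is by induction on derivations; besides persistence and the empty-state property it uses
-- that declaratives are truth-conditional, and excluded middle for (DDN), (Split) and some frame axioms.
--
-- Completeness goes through a canonical model whose worlds are the prime theories that are consistent
-- and decide every declarative. Every formula is equivalent to the inquisitive disjunction of its
-- finitely many declarative resolutions, and a state supports φ exactly when some resolution of φ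
-- belongs to all of its worlds; a neighbourhood of a world Γ is a nonempty state closed, in this
-- sense, under the conditionals φ ⇛ ψ ∈ Γ. The conditionals of Γ order formulas as a distributive
-- prelattice, so each φ ⇛ ψ ∉ Γ is refuted by the state of a prime filter of that prelattice. All
-- prime filters come from one application of Zorn's lemma (maximal filters avoiding a ⊔-closed set),
-- and each axiom of Λ makes the canonical frame satisfy the corresponding condition.

module Submission where

open import Defs
open import Level using (Level; lift; lower) renaming (suc to lsuc; zero to lzero)
open import Data.Bool using (Bool; true; T)
open import Data.Bool.Properties using (T-≡)
open import Data.Product using (Σ; ∃; ∃₂; _×_; _,_; proj₁; proj₂)
open import Data.Sum as Sum using (_⊎_; inj₁; inj₂)
open import Data.Empty using (⊥; ⊥-elim)
open import Data.Unit using (tt) renaming (⊤ to Unit)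
open import Data.List using (List; []; _∷_; [_]; _++_; map; cartesianProductWith)
open import Data.List.Membership.Propositional using (_∈_; lose; find)
open import Data.List.Membership.Propositional.Properties using (∈-map⁺; ∈-++⁺ˡ; ∈-++⁺ʳ)
open import Data.List.Relation.Unary.All as All using (All; []; _∷_)
open import Data.List.Relation.Unary.Any as Any using (Any; here; there)
import Data.List.Relation.Unary.All.Properties as All
import Data.List.Relation.Unary.Any.Properties as Any
open import Function.Bundles using (_⇔_; mk⇔; Equivalence)
open import Relation.Nullary using (¬_; Dec; yes; no; T?)
open import Relation.Nullary.Decidable using (⌊_⌋; fromSum; toWitness; fromWitness; decidable-stable)
open import Relation.Binary.PropositionalEquality using (_≡_; refl; subst; setoid)

-- Excluded middle decides every proposition, of any universe level, by a boolean, so a comprehension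
-- ｛ x ∣ Q x ｝ lives in Set whatever the level of Q (propositional resizing).
module Classical (lem : ExcludedMiddleω) where

  decide : ∀ {ℓ} (A : Set ℓ) → Dec A
  decide A = fromSum lem

  ClassicalSet : ∀ {a} → Set a → Set a
  ClassicalSet A = A → Bool

  module _ {a} {A : Set a} where

    infix 2.5 _∈ᶜ_ _∉ᶜ_
    infix 4 _⊆ᶜ_

    _∈ᶜ_ : A → ClassicalSet A → Set
    x ∈ᶜ S = T (S x)

    _∉ᶜ_ : A → ClassicalSet A → Set
    x ∉ᶜ S = ¬ (x ∈ᶜ S)

    _⊆ᶜ_ : ClassicalSet A → ClassicalSet A → Set a
    S ⊆ᶜ S′ = ∀ x → x ∈ᶜ S → x ∈ᶜ S′

    ∈ᶜ-or-∉ᶜ : (S : ClassicalSet A) (x : A) → x ∈ᶜ S ⊎ x ∉ᶜ S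
    ∈ᶜ-or-∉ᶜ S x with T? (S x)
    ... | yes x∈ = inj₁ x∈
    ... | no x∉ = inj₂ x∉

    ∈ᶜ-stable : (S : ClassicalSet A) {x : A} → ¬ (x ∉ᶜ S) → x ∈ᶜ S
    ∈ᶜ-stable S {x} = decidable-stable (T? (S x))

    comprehension : ∀ {ℓ} → (A → Set ℓ) → ClassicalSet A
    comprehension Q x = ⌊ decide (Q x) ⌋

    syntax comprehension (λ x → Q) = ｛ x ∣ Q ｝

    ∈-comprehension⁺ : ∀ {ℓ} (Q : A → Set ℓ) {x} → Q x → x ∈ᶜ ｛ y ∣ Q y ｝
    ∈-comprehension⁺ _ = fromWitness

    ∈-comprehension⁻ : ∀ {ℓ} (Q : A → Set ℓ) {x} → x ∈ᶜ ｛ y ∣ Q y ｝ → Q x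
    ∈-comprehension⁻ _ = toWitness

module Soundness (lem : ExcludedMiddleω) {P : Set} {ℓ : Level} (M : InModel P ℓ) where
  open InModel M
  open Classical lem

  infix 4 _⊨ₘ_

  _⊨ₘ_ : Pred W → Form P → Set (lsuc ℓ)
  _⊨ₘ_ = _⊨_ M

  ⁅_⁆ : W → Pred W
  ⁅ w ⁆ v = v ≡ w

  ⁅⁆⊆ : ∀ {s : Pred W} {w} → s w → ⁅ w ⁆ ⊆ s
  ⁅⁆⊆ {s} sw v refl = sw

  ⊨-persistent : ∀ φ {s t : Pred W} → t ⊆ s → s ⊨ₘ φ → t ⊨ₘ φ
  ⊨-persistent (atom p) t⊆s h = lift λ w tw → lower h w (t⊆s w tw)
  ⊨-persistent ⊥f      t⊆s h = lift λ w tw → lower h w (t⊆s w tw)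
  ⊨-persistent (φ ∧ ψ) t⊆s (hφ , hψ) = ⊨-persistent φ t⊆s hφ , ⊨-persistent ψ t⊆s hψ
  ⊨-persistent (φ ⩒ ψ) t⊆s (inj₁ hφ) = inj₁ (⊨-persistent φ t⊆s hφ)
  ⊨-persistent (φ ⩒ ψ) t⊆s (inj₂ hψ) = inj₂ (⊨-persistent ψ t⊆s hψ)
  ⊨-persistent (φ ⇒ ψ) t⊆s h u u⊆t = h u λ w uw → t⊆s w (u⊆t w uw)
  ⊨-persistent (φ ⇛ ψ) t⊆s h w tw = h w (t⊆s w tw)

  ⊨-empty : ∀ φ {s : Pred W} → (∀ w → ¬ s w) → s ⊨ₘ φ
  ⊨-empty (atom p) s-empty = lift λ w sw → ⊥-elim (s-empty w sw)
  ⊨-empty ⊥f      s-empty = lift s-empty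
  ⊨-empty (φ ∧ ψ) s-empty = ⊨-empty φ s-empty , ⊨-empty ψ s-empty
  ⊨-empty (φ ⩒ ψ) s-empty = inj₁ (⊨-empty φ s-empty)
  ⊨-empty (φ ⇒ ψ) s-empty t t⊆s _ = ⊨-empty ψ λ w tw → s-empty w (t⊆s w tw)
  ⊨-empty (φ ⇛ ψ) s-empty w sw = ⊥-elim (s-empty w sw)

  ⊨-⊤ : ∀ {s : Pred W} → s ⊨ₘ ⊤f
  ⊨-⊤ _ _ h = h

  declarative-truthConditional : ∀ {α} → Declarative α → ∀ {s : Pred W} →
                                 (∀ w → s w → ⁅ w ⁆ ⊨ₘ α) → s ⊨ₘ α
  declarative-truthConditional (d-atom p) h = lift λ w sw → lower (h w sw) w refl
  declarative-truthConditional d-⊥ h = lift λ w sw → lower (h w sw) w refl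
  declarative-truthConditional (d-∧ dα dβ) h =
    declarative-truthConditional dα (λ w sw → proj₁ (h w sw)) ,
    declarative-truthConditional dβ (λ w sw → proj₂ (h w sw))
  declarative-truthConditional (d-⇒ {α} dα dβ) h t t⊆s tα =
    declarative-truthConditional dβ λ w tw →
      h w (t⊆s w tw) ⁅ w ⁆ (λ v v≡w → v≡w) (⊨-persistent α (⁅⁆⊆ tw) tα)
  declarative-truthConditional (d-⇛ φ ψ) h w sw = h w sw w refl

  ⁅⁆⊨¬ : ∀ χ {w} → ¬ ⁅ w ⁆ ⊨ₘ χ → ⁅ w ⁆ ⊨ₘ ¬f χ
  ⁅⁆⊨¬ χ {w} w⊭χ t t⊆w tχ = lift λ v tv → w⊭χ (⊨-persistent χ (⁅⁆⊆ (subst t (t⊆w v tv) tv)) tχ)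

  ⊨¬⇛-counterexample : ∀ {u : Pred W} {w} φ ψ → u ⊨ₘ ¬f (φ ⇛ ψ) → u w →
                      ∃ λ t → Sg w t × t ⊨ₘ φ × ¬ t ⊨ₘ ψ
  ⊨¬⇛-counterexample {u} {w} φ ψ u⊨¬ uw with lem {A = ∃ λ t → Sg w t × t ⊨ₘ φ × ¬ t ⊨ₘ ψ}
  ... | inj₁ counterexample = counterexample
  ... | inj₂ none = ⊥-elim (lower (u⊨¬ ⁅ w ⁆ (⁅⁆⊆ uw) w⊨φ⇛ψ) w refl)
    where
    w⊨φ⇛ψ : ⁅ w ⁆ ⊨ₘ (φ ⇛ ψ)
    w⊨φ⇛ψ _ refl t σt tφ with lem {A = t ⊨ₘ ψ}
    ... | inj₁ tψ = tψ
    ... | inj₂ t⊭ψ = ⊥-elim (none (t , σt , tφ , t⊭ψ))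

  -- The comprehension keeps this state in Set ℓ, although ⁅ v ⁆ ⊨ₘ α lives in Set (lsuc ℓ).
  _∩⟦_⟧ : Pred W → Form P → Pred W
  (t ∩⟦ α ⟧) w = t w × w ∈ᶜ ｛ v ∣ ⁅ v ⁆ ⊨ₘ α ｝

  ∩⟦⟧-supports : ∀ {α} → Declarative α → ∀ {t} → (t ∩⟦ α ⟧) ⊨ₘ α
  ∩⟦⟧-supports dα = declarative-truthConditional dα λ _ x → ∈-comprehension⁻ (λ v → ⁅ v ⁆ ⊨ₘ _) (proj₂ x)

  ∩⟦⟧-greatest : ∀ α {t u} → u ⊆ t → u ⊨ₘ α → u ⊆ (t ∩⟦ α ⟧)
  ∩⟦⟧-greatest α u⊆t uα v uv = u⊆t v uv , ∈-comprehension⁺ (λ v → ⁅ v ⁆ ⊨ₘ α) (⊨-persistent α (⁅⁆⊆ uv) uα)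

  condAxiom-valid : ∀ c → FrameCond M c → ∀ {φ} → CondAxiom c φ → ∀ s → s ⊨ₘ φ
  condAxiom-valid downMono down (ax-downMono φ ψ) _ t _ φ⇛ψ w tw u σu _ u′ u′⊆u u′φ
    with lem {A = Nonempty u′}
  ... | inj₁ u′≠∅ = φ⇛ψ w tw u′ (down w u u′ u′≠∅ u′⊆u σu) u′φ
  ... | inj₂ u′=∅ = ⊨-empty ψ λ v u′v → u′=∅ (v , u′v)
  condAxiom-valid unionClosed union (ax-unionClosed α φ ψ dα) _ t _ α⇛φ⩒ψ u u⊆t (u¬φ , u¬ψ) =
    lift refute
    where
    refute : ∀ w → ¬ u w
    refute w uw with ⊨¬⇛-counterexample α φ u¬φ uw | ⊨¬⇛-counterexample α ψ u¬ψ uw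
    ... | (t₁ , σt₁ , t₁α , t₁⊭φ) | (t₂ , σt₂ , t₂α , t₂⊭ψ)
      with α⇛φ⩒ψ w (u⊆t w uw) (t₁ ∪ t₂) (union w t₁ t₂ σt₁ σt₂) t₁∪t₂⊨α
      where
      t₁∪t₂⊨α : (t₁ ∪ t₂) ⊨ₘ α
      t₁∪t₂⊨α = declarative-truthConditional dα λ where
        v (inj₁ t₁v) → ⊨-persistent α (⁅⁆⊆ t₁v) t₁α
        v (inj₂ t₂v) → ⊨-persistent α (⁅⁆⊆ t₂v) t₂α
    ... | inj₁ t₁∪t₂⊨φ = t₁⊭φ (⊨-persistent φ (λ _ → inj₁) t₁∪t₂⊨φ)
    ... | inj₂ t₁∪t₂⊨ψ = t₂⊭ψ (⊨-persistent ψ (λ _ → inj₂) t₁∪t₂⊨ψ)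
  condAxiom-valid reflexive refl-R (ax-reflexive α dα) _ t _ ⊞α =
    declarative-truthConditional dα λ w tw → at w tw (refl-R w)
    where
    at : ∀ w → t w → R M w w → ⁅ w ⁆ ⊨ₘ α
    at w tw (u , σu , uw) = ⊨-persistent α (⁅⁆⊆ uw) (⊞α w tw u σu ⊨-⊤)
  condAxiom-valid nonTrivial nonTriv ax-nonTrivial _ t _ ⊞⊥ = lift λ w tw → refute w tw (nonTriv w)
    where
    refute : ∀ w → t w → ∃ (Sg w) → ⊥
    refute w tw (u , σu) = let v , uv = Sg-ne w u σu in lower (⊞⊥ w tw u σu ⊨-⊤) v uv
  condAxiom-valid decreasing decr (ax-decreasing φ ψ) _ t _ φ⇛ψ w tw u σu _ v uv t′ σ′t′ =
    φ⇛ψ w tw t′ (decr w v (u , σu , uv) t′ σ′t′)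
  condAxiom-valid increasing incr (ax-increasing φ ψ) _ t _ ¬φ⇛ψ w tw u σu _ u′ u′⊆u u′⊨φ⇛ψ =
    lift λ v u′v →
      let t₁ , σt₁ , t₁φ , t₁⊭ψ = ⊨¬⇛-counterexample φ ψ ¬φ⇛ψ tw
      in t₁⊭ψ (u′⊨φ⇛ψ v u′v t₁ (incr w v (u , σu , u′⊆u v u′v) t₁ σt₁) t₁φ)

  module _ {Λ : CondSet} (sat : FrameSat Λ M) where

    derivable-valid : ∀ {φ} → Derivable Λ φ → ∀ s → s ⊨ₘ φ
    derivable-valid (ax-K φ ψ) _ t _ tφ u u⊆t _ = ⊨-persistent φ u⊆t tφ
    derivable-valid (ax-S φ ψ χ) _ t _ f u u⊆t g v v⊆u vφ =
      f v (λ x vx → u⊆t x (v⊆u x vx)) vφ v (λ _ vx → vx) (g v v⊆u vφ)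
    derivable-valid (ax-∧E₁ φ ψ) _ _ _ = proj₁
    derivable-valid (ax-∧E₂ φ ψ) _ _ _ = proj₂
    derivable-valid (ax-∧I φ ψ) _ t _ tφ u u⊆t uψ = ⊨-persistent φ u⊆t tφ , uψ
    derivable-valid (ax-⩒I₁ φ ψ) _ _ _ = inj₁
    derivable-valid (ax-⩒I₂ φ ψ) _ _ _ = inj₂
    derivable-valid (ax-⩒E φ ψ χ) _ t _ f u u⊆t g v v⊆u (inj₁ vφ) = f v (λ x vx → u⊆t x (v⊆u x vx)) vφ
    derivable-valid (ax-⩒E φ ψ χ) _ t _ f u u⊆t g v v⊆u (inj₂ vψ) = g v v⊆u vψ
    derivable-valid (ax-EFQ φ) _ _ _ t⊨⊥ = ⊨-empty φ (lower t⊨⊥)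
    derivable-valid (ax-DDN α dα) _ t _ ¬¬α = declarative-truthConditional dα at
      where
      at : ∀ w → t w → ⁅ w ⁆ ⊨ₘ α
      at w tw with lem {A = ⁅ w ⁆ ⊨ₘ α}
      ... | inj₁ wα = wα
      ... | inj₂ w⊭α = ⊥-elim (lower (¬¬α ⁅ w ⁆ (⁅⁆⊆ tw) (⁅⁆⊨¬ α w⊭α)) w refl)
    derivable-valid (ax-Split α φ ψ dα) _ t _ α→φ⩒ψ
      with α→φ⩒ψ (t ∩⟦ α ⟧) (λ _ → proj₁) (∩⟦⟧-supports dα)
    ... | inj₁ tαφ = inj₁ λ u u⊆t uα → ⊨-persistent φ (∩⟦⟧-greatest α u⊆t uα) tαφ
    ... | inj₂ tαψ = inj₂ λ u u⊆t uα → ⊨-persistent ψ (∩⟦⟧-greatest α u⊆t uα) tαψ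
    derivable-valid (ax-Trans φ ψ χ) _ _ _ (φ⇛ψ , ψ⇛χ) w tw u σu uφ = ψ⇛χ w tw u σu (φ⇛ψ w tw u σu uφ)
    derivable-valid (ax-RConj φ ψ χ) _ _ _ (φ⇛ψ , φ⇛χ) w tw u σu uφ = φ⇛ψ w tw u σu uφ , φ⇛χ w tw u σu uφ
    derivable-valid (ax-LDisj φ ψ χ) _ _ _ (φ⇛χ , ψ⇛χ) w tw u σu (inj₁ uφ) = φ⇛χ w tw u σu uφ
    derivable-valid (ax-LDisj φ ψ χ) _ _ _ (φ⇛χ , ψ⇛χ) w tw u σu (inj₂ uψ) = ψ⇛χ w tw u σu uψ
    derivable-valid (ax-Λ c φ c∈Λ ax) = condAxiom-valid c (sat c c∈Λ) ax
    derivable-valid (mp φ→ψ φ) s = derivable-valid φ→ψ s s (λ _ sx → sx) (derivable-valid φ s)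
    derivable-valid (cn φ→ψ) _ _ _ t _ tφ = derivable-valid φ→ψ t t (λ _ tx → tx) tφ

soundness : ExcludedMiddleω → {P : Set} (Λ : CondSet) (Φ : Form P → Set) (ψ : Form P) →
            Φ ⊢[ Λ ] ψ → Consequence Φ Λ ψ
soundness lem Λ Φ ψ ([] , _ , ⊢ψ) ℓ M sat s _ = derivable-valid sat ⊢ψ s
  where open Soundness lem M
soundness lem Λ Φ ψ ((φ ∷ φs) , Φφs , ⊢φs→ψ) ℓ M sat s s⊨Φ =
  derivable-valid sat ⊢φs→ψ s s (λ _ sx → sx) (s⊨conj φ φs Φφs)
  where
  open Soundness lem M
  s⊨conj : ∀ φ φs → All Φ (φ ∷ φs) → s ⊨ₘ conj φ φs
  s⊨conj φ []       (Φφ ∷ []) = s⊨Φ φ Φφ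
  s⊨conj φ (χ ∷ χs) (Φφ ∷ Φχs) = s⊨Φ φ Φφ , s⊨conj χ χs Φχs

module Deduction {P : Set} (Λ : CondSet) where

  infix 2.5 ⊢_ _⊩_

  ⊢_ : Form P → Set
  ⊢_ = Derivable Λ

  private variable
    Γ Δ : List (Form P)
    φ ψ χ : Form P

  ⊢-K : ∀ φ → ⊢ ψ → ⊢ φ ⇒ ψ
  ⊢-K φ ⊢ψ = mp (ax-K _ φ) ⊢ψ

  ⊢-S : ⊢ φ ⇒ ψ ⇒ χ → ⊢ φ ⇒ ψ → ⊢ φ ⇒ χ
  ⊢-S ⊢φψχ ⊢φψ = mp (mp (ax-S _ _ _) ⊢φψχ) ⊢φψ

  ⊢-refl : ∀ φ → ⊢ φ ⇒ φ
  ⊢-refl φ = ⊢-S (ax-K φ (φ ⇒ φ)) (ax-K φ φ)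

  ⊢-trans : ⊢ φ ⇒ ψ → ⊢ ψ ⇒ χ → ⊢ φ ⇒ χ
  ⊢-trans ⊢φψ ⊢ψχ = ⊢-S (⊢-K _ ⊢ψχ) ⊢φψ

  ⊢⊤ : ⊢ ⊤f
  ⊢⊤ = ⊢-refl ⊥f

  ⋀ : List (Form P) → Form P
  ⋀ []      = ⊤f
  ⋀ (χ ∷ Γ) = ⋀ Γ ∧ χ

  _⊩_ : List (Form P) → Form P → Set
  Γ ⊩ φ = ⊢ ⋀ Γ ⇒ φ

  #0 : φ ∷ Γ ⊩ φ
  #0 = ax-∧E₂ _ _

  weaken : Γ ⊩ ψ → φ ∷ Γ ⊩ ψ
  weaken = ⊢-trans (ax-∧E₁ _ _)

  #1 : ψ ∷ φ ∷ Γ ⊩ φ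
  #1 = weaken #0

  #2 : χ ∷ ψ ∷ φ ∷ Γ ⊩ φ
  #2 = weaken #1

  hypothesis : φ ∈ Γ → Γ ⊩ φ
  hypothesis (here refl) = #0
  hypothesis (there φ∈Γ) = weaken (hypothesis φ∈Γ)

  infixl 5 _·_

  _·_ : Γ ⊩ φ ⇒ ψ → Γ ⊩ φ → Γ ⊩ ψ
  _·_ = ⊢-S

  ƛ_ : φ ∷ Γ ⊩ ψ → Γ ⊩ φ ⇒ ψ
  ƛ_ {φ = φ} {Γ = Γ} {ψ = ψ} d = ⊢-trans (ax-∧I (⋀ Γ) φ) (mp (ax-S φ (⋀ Γ ∧ φ) ψ) (⊢-K φ d))

  axiom : ⊢ φ → Γ ⊩ φ
  axiom = ⊢-K _

  by : ⊢ φ ⇒ ψ → Γ ⊩ φ → Γ ⊩ ψ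
  by ⊢φψ d = axiom ⊢φψ · d

  ⟨_,_⟩ : Γ ⊩ φ → Γ ⊩ ψ → Γ ⊩ φ ∧ ψ
  ⟨ d , e ⟩ = axiom (ax-∧I _ _) · d · e

  π₁ : Γ ⊩ φ ∧ ψ → Γ ⊩ φ
  π₁ = by (ax-∧E₁ _ _)

  π₂ : Γ ⊩ φ ∧ ψ → Γ ⊩ ψ
  π₂ = by (ax-∧E₂ _ _)

  ι₁ : Γ ⊩ φ → Γ ⊩ φ ⩒ ψ
  ι₁ = by (ax-⩒I₁ _ _)

  ι₂ : Γ ⊩ ψ → Γ ⊩ φ ⩒ ψ
  ι₂ = by (ax-⩒I₂ _ _)

  case : Γ ⊩ φ ⩒ ψ → φ ∷ Γ ⊩ χ → ψ ∷ Γ ⊩ χ → Γ ⊩ χ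
  case d l r = axiom (ax-⩒E _ _ _) · (ƛ l) · (ƛ r) · d

  efq : Γ ⊩ ⊥f → Γ ⊩ φ
  efq = by (ax-EFQ _)

  ⋀-⊆ : (∀ {χ} → χ ∈ Γ → χ ∈ Δ) → Δ ⊩ ⋀ Γ
  ⋀-⊆ {Γ = []}    _     = axiom ⊢⊤
  ⋀-⊆ {Γ = φ ∷ Γ} Γ⊆Δ = ⟨ ⋀-⊆ (λ χ∈ → Γ⊆Δ (there χ∈)) , hypothesis (Γ⊆Δ (here refl)) ⟩

  ⊩-weaken : (∀ {χ} → χ ∈ Γ → χ ∈ Δ) → Γ ⊩ φ → Δ ⊩ φ
  ⊩-weaken Γ⊆Δ = ⊢-trans (⋀-⊆ Γ⊆Δ)

  ⋀-declarative : All Declarative Δ → Declarative (⋀ Δ)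
  ⋀-declarative []        = d-⇒ d-⊥ d-⊥
  ⋀-declarative (dα ∷ dΔ) = d-∧ (⋀-declarative dΔ) dα

  closed : [] ⊩ φ → ⊢ φ
  closed d = mp d ⊢⊤

  deduction : φ ∷ [] ⊩ ψ → ⊢ φ ⇒ ψ
  deduction d = closed (ƛ d)

  ⊢-curry : ⊢ φ ∧ ψ ⇒ χ → ⊢ φ ⇒ ψ ⇒ χ
  ⊢-curry ⊢φψχ = closed (ƛ ƛ by ⊢φψχ ⟨ #1 , #0 ⟩)

record DistributivePrelattice (A : Set) : Set₁ where
  infix  4 _≤_
  infixr 6 _⊓_
  infixr 5 _⊔_
  field
    _≤_          : A → A → Set
    _⊓_ _⊔_      : A → A → A
    ⊤            : A
    ≤-refl       : ∀ {x} → x ≤ x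
    ≤-trans      : ∀ {x y z} → x ≤ y → y ≤ z → x ≤ z
    x⊓y≤x        : ∀ x y → x ⊓ y ≤ x
    x⊓y≤y        : ∀ x y → x ⊓ y ≤ y
    ⊓-greatest   : ∀ {x y z} → z ≤ x → z ≤ y → z ≤ x ⊓ y
    x≤x⊔y        : ∀ x y → x ≤ x ⊔ y
    y≤x⊔y        : ∀ x y → y ≤ x ⊔ y
    ⊔-least      : ∀ {x y z} → x ≤ z → y ≤ z → x ⊔ y ≤ z
    ⊓-distribˡ-⊔ : ∀ x y z → x ⊓ (y ⊔ z) ≤ (x ⊓ y) ⊔ (x ⊓ z)
    ≤-maximum    : ∀ x → x ≤ ⊤

module PrimeFilters (lem : ExcludedMiddleω) (zorn : Zornω) {A : Set} (L : DistributivePrelattice A) where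
  open DistributivePrelattice L
  open Classical lem

  record IsFilter (S : ClassicalSet A) : Set where
    field
      ⊤∈       : ⊤ ∈ᶜ S
      ⊓-closed : ∀ {x y} → x ∈ᶜ S → y ∈ᶜ S → x ⊓ y ∈ᶜ S
      ≤-closed : ∀ {x y} → x ≤ y → x ∈ᶜ S → y ∈ᶜ S

  IsPrime : ClassicalSet A → Set
  IsPrime S = ∀ {x y} → x ⊔ y ∈ᶜ S → x ∈ᶜ S ⊎ y ∈ᶜ S

  ⊓-monoˡ : ∀ {x y} z → x ≤ y → x ⊓ z ≤ y ⊓ z
  ⊓-monoˡ z x≤y = ⊓-greatest (≤-trans (x⊓y≤x _ _) x≤y) (x⊓y≤y _ _)

  GeneratedBy : ClassicalSet A → A → A → Set
  GeneratedBy S a x = ∃ λ f → f ∈ᶜ S × f ⊓ a ≤ x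

  adjoin : ClassicalSet A → A → ClassicalSet A
  adjoin S a = ｛ x ∣ GeneratedBy S a x ｝

  module _ {S : ClassicalSet A} (S-filter : IsFilter S) (a : A) where
    open IsFilter S-filter

    adjoin-isFilter : IsFilter (adjoin S a)
    adjoin-isFilter = record
      { ⊤∈       = ∈-comprehension⁺ Q (⊤ , ⊤∈ , ≤-maximum _)
      ; ⊓-closed = λ x∈ y∈ → ∈-comprehension⁺ Q (⊓-witness (∈-comprehension⁻ Q x∈) (∈-comprehension⁻ Q y∈))
      ; ≤-closed = λ x≤y x∈ → let f , f∈ , f⊓a≤x = ∈-comprehension⁻ Q x∈ in
                              ∈-comprehension⁺ Q (f , f∈ , ≤-trans f⊓a≤x x≤y)
      }
      where
      Q : A → Set
      Q = GeneratedBy S a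
      ⊓-witness : ∀ {x y} → Q x → Q y → Q (x ⊓ y)
      ⊓-witness (f , f∈ , f⊓a≤x) (g , g∈ , g⊓a≤y) =
        f ⊓ g , ⊓-closed f∈ g∈ ,
        ⊓-greatest (≤-trans (⊓-monoˡ a (x⊓y≤x f g)) f⊓a≤x) (≤-trans (⊓-monoˡ a (x⊓y≤y f g)) g⊓a≤y)

    ⊆-adjoin : S ⊆ᶜ adjoin S a
    ⊆-adjoin x x∈ = ∈-comprehension⁺ (GeneratedBy S a) (x , x∈ , x⊓y≤x x a)

    ∈-adjoin : a ∈ᶜ adjoin S a
    ∈-adjoin = ∈-comprehension⁺ (GeneratedBy S a) (⊤ , ⊤∈ , x⊓y≤y ⊤ a)

  AdjoinMeets : ClassicalSet A → (A → Set) → A → Set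
  AdjoinMeets S I a = ∃₂ λ f x → f ∈ᶜ S × I x × f ⊓ a ≤ x

  module _ (F₀ : ClassicalSet A) (I : A → Set) where

    record Separating (S : ClassicalSet A) : Set where
      field
        isFilter : IsFilter S
        extends  : F₀ ⊆ᶜ S
        avoids   : ∀ {x} → x ∈ᶜ S → ¬ I x

    adjoin-separating : ∀ {S} a → Separating S → ¬ AdjoinMeets S I a → Separating (adjoin S a)
    adjoin-separating {S} a S-separating no-meet = record
      { isFilter = adjoin-isFilter isFilter a
      ; extends  = λ x x∈F₀ → ⊆-adjoin isFilter a x (extends x x∈F₀)
      ; avoids   = λ x∈ Ix → let f , f∈ , f⊓a≤x = ∈-comprehension⁻ (GeneratedBy S a) x∈
                             in no-meet (f , _ , f∈ , Ix , f⊓a≤x)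
      }
      where open Separating S-separating

    Candidate : Set
    Candidate = Σ (ClassicalSet A) Separating

    _≼_ : Candidate → Candidate → Set
    S ≼ S′ = proj₁ S ⊆ᶜ proj₁ S′

    module ChainUnion (F₀-separating : Separating F₀) (C : Candidate → Set)
                      (chain : ∀ S S′ → C S → C S′ → S ≼ S′ ⊎ S′ ≼ S) where
      open IsFilter
      open Separating

      -- F₀ is included so that the empty chain is bounded too.
      InUnion : A → Set
      InUnion x = x ∈ᶜ F₀ ⊎ ∃ λ S → C S × x ∈ᶜ proj₁ S

      ⋃C : ClassicalSet A
      ⋃C = ｛ x ∣ InUnion x ｝

      inCommonMember : ∀ {x y} → InUnion x → InUnion y →
                       (x ∈ᶜ F₀ × y ∈ᶜ F₀) ⊎ ∃ λ S → C S × x ∈ᶜ proj₁ S × y ∈ᶜ proj₁ S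
      inCommonMember (inj₁ x∈) (inj₁ y∈) = inj₁ (x∈ , y∈)
      inCommonMember (inj₁ x∈) (inj₂ (S , CS , y∈)) = inj₂ (S , CS , extends (proj₂ S) _ x∈ , y∈)
      inCommonMember (inj₂ (S , CS , x∈)) (inj₁ y∈) = inj₂ (S , CS , x∈ , extends (proj₂ S) _ y∈)
      inCommonMember (inj₂ (S , CS , x∈)) (inj₂ (S′ , CS′ , y∈)) with chain S S′ CS CS′
      ... | inj₁ S≼S′ = inj₂ (S′ , CS′ , S≼S′ _ x∈ , y∈)
      ... | inj₂ S′≼S = inj₂ (S , CS , x∈ , S′≼S _ y∈)

      ⊓-InUnion : ∀ {x y} → InUnion x → InUnion y → InUnion (x ⊓ y)
      ⊓-InUnion x∈ y∈ with inCommonMember x∈ y∈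
      ... | inj₁ (x∈F₀ , y∈F₀) = inj₁ (⊓-closed (isFilter F₀-separating) x∈F₀ y∈F₀)
      ... | inj₂ (S , CS , x∈S , y∈S) = inj₂ (S , CS , ⊓-closed (isFilter (proj₂ S)) x∈S y∈S)

      ≤-InUnion : ∀ {x y} → x ≤ y → InUnion x → InUnion y
      ≤-InUnion x≤y (inj₁ x∈F₀) = inj₁ (≤-closed (isFilter F₀-separating) x≤y x∈F₀)
      ≤-InUnion x≤y (inj₂ (S , CS , x∈S)) = inj₂ (S , CS , ≤-closed (isFilter (proj₂ S)) x≤y x∈S)

      InUnion-avoids : ∀ {x} → InUnion x → ¬ I x
      InUnion-avoids (inj₁ x∈F₀) = avoids F₀-separating x∈F₀
      InUnion-avoids (inj₂ (S , _ , x∈S)) = avoids (proj₂ S) x∈S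

      ⋃C-separating : Separating ⋃C
      ⋃C-separating = record
        { isFilter = record
          { ⊤∈       = ∈⋃C (inj₁ (⊤∈ (isFilter F₀-separating)))
          ; ⊓-closed = λ x∈ y∈ → ∈⋃C (⊓-InUnion (∈-comprehension⁻ InUnion x∈) (∈-comprehension⁻ InUnion y∈))
          ; ≤-closed = λ x≤y x∈ → ∈⋃C (≤-InUnion x≤y (∈-comprehension⁻ InUnion x∈))
          }
        ; extends  = λ x x∈ → ∈⋃C (inj₁ x∈)
        ; avoids   = λ x∈ → InUnion-avoids (∈-comprehension⁻ InUnion x∈)
        }
        where
        ∈⋃C : ∀ {x} → InUnion x → x ∈ᶜ ⋃C
        ∈⋃C = ∈-comprehension⁺ InUnion

      ⋃C-candidate : Candidate
      ⋃C-candidate = ⋃C , ⋃C-separating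

      ⋃C-upperBound : ∀ S → C S → S ≼ ⋃C-candidate
      ⋃C-upperBound S CS x x∈S = ∈-comprehension⁺ InUnion (inj₂ (S , CS , x∈S))

  record MaximalFilter (F₀ : ClassicalSet A) (I : A → Set) : Set where
    field
      carrier    : ClassicalSet A
      separating : Separating F₀ I carrier
      maximal    : ∀ {a} → a ∉ᶜ carrier → AdjoinMeets carrier I a
    open Separating separating public

  maximalFilter-isPrime : ∀ {F₀ I} → (F : MaximalFilter F₀ I) → (∀ {x y} → I x → I y → I (x ⊔ y)) →
                          IsPrime (MaximalFilter.carrier F)
  maximalFilter-isPrime F I-⊔ {a} {b} a⊔b∈ with ∈ᶜ-or-∉ᶜ carrier a | ∈ᶜ-or-∉ᶜ carrier b
    where open MaximalFilter F
  ... | inj₁ a∈ | _ = inj₁ a∈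
  ... | inj₂ _ | inj₁ b∈ = inj₂ b∈
  ... | inj₂ a∉ | inj₂ b∉ =
    let f , x , f∈ , Ix , f⊓a≤x = maximal a∉
        g , y , g∈ , Iy , g⊓b≤y = maximal b∉
        f⊓g⊓[a⊔b]≤x⊔y = ≤-trans (⊓-distribˡ-⊔ (f ⊓ g) a b)
          (⊔-least (≤-trans (⊓-monoˡ a (x⊓y≤x f g)) (≤-trans f⊓a≤x (x≤x⊔y x y)))
                   (≤-trans (⊓-monoˡ b (x⊓y≤y f g)) (≤-trans g⊓b≤y (y≤x⊔y x y))))
    in ⊥-elim (avoids (≤-closed f⊓g⊓[a⊔b]≤x⊔y (⊓-closed (⊓-closed f∈ g∈) a⊔b∈)) (I-⊔ Ix Iy))
    where
    open MaximalFilter F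
    open IsFilter isFilter

  maximalFilter : ∀ F₀ I → Separating F₀ I F₀ → MaximalFilter F₀ I
  maximalFilter F₀ I F₀-separating = record
    { carrier    = proj₁ M
    ; separating = proj₂ M
    ; maximal    = maximal
    }
    where
    bounded : (C : Candidate F₀ I → Set) → (∀ S S′ → C S → C S′ → _≼_ F₀ I S S′ ⊎ _≼_ F₀ I S′ S) →
              ∃ λ U → ∀ S → C S → _≼_ F₀ I S U
    bounded C chain = ⋃C-candidate , ⋃C-upperBound
      where open ChainUnion F₀ I F₀-separating C chain
    zorn-maximal : ∃ λ M → ∀ S → _≼_ F₀ I M S → _≼_ F₀ I S M
    zorn-maximal = zorn (Candidate F₀ I) (_≼_ F₀ I) (λ _ x∈ → x∈) (λ S≼S′ S′≼S″ x x∈ → S′≼S″ x (S≼S′ x x∈)) bounded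
    M : Candidate F₀ I
    M = proj₁ zorn-maximal
    maximal : ∀ {a} → a ∉ᶜ proj₁ M → AdjoinMeets (proj₁ M) I a
    maximal {a} a∉M with lem {A = AdjoinMeets (proj₁ M) I a}
    ... | inj₁ meets = meets
    ... | inj₂ no-meet =
      ⊥-elim (a∉M (proj₂ zorn-maximal (adjoin (proj₁ M) a , adjoin-separating F₀ I a (proj₂ M) no-meet)
                                      (⊆-adjoin M-filter a) a (∈-adjoin M-filter a)))
      where
      M-filter : IsFilter (proj₁ M)
      M-filter = Separating.isFilter (proj₂ M)

  ↓_ : A → A → Set
  (↓ b) x = x ≤ b

  ↑_ : A → ClassicalSet A
  ↑ a = ｛ x ∣ a ≤ x ｝

  ↑-isFilter : ∀ a → IsFilter (↑ a)
  ↑-isFilter a = record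
    { ⊤∈       = ∈⁺ (≤-maximum a)
    ; ⊓-closed = λ x∈ y∈ → ∈⁺ (⊓-greatest (∈⁻ x∈) (∈⁻ y∈))
    ; ≤-closed = λ x≤y x∈ → ∈⁺ (≤-trans (∈⁻ x∈) x≤y)
    }
    where
    ∈⁺ : ∀ {x} → a ≤ x → x ∈ᶜ ↑ a
    ∈⁺ = ∈-comprehension⁺ (a ≤_)
    ∈⁻ : ∀ {x} → x ∈ᶜ ↑ a → a ≤ x
    ∈⁻ = ∈-comprehension⁻ (a ≤_)

  a∈↑a : ∀ a → a ∈ᶜ ↑ a
  a∈↑a a = ∈-comprehension⁺ (a ≤_) ≤-refl

  IsPrimeFilter : ClassicalSet A → Set
  IsPrimeFilter S = IsFilter S × IsPrime S

  maximalFilter-below : ∀ {F₀ b} → IsFilter F₀ → b ∉ᶜ F₀ → MaximalFilter F₀ (↓ b)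
  maximalFilter-below {F₀} F₀-filter b∉F₀ =
    maximalFilter F₀ (↓ _) record
      { isFilter = F₀-filter
      ; extends  = λ _ x∈ → x∈
      ; avoids   = λ x∈ x≤b → b∉F₀ (IsFilter.≤-closed F₀-filter x≤b x∈)
      }

  primeFilterTheorem : ∀ {F₀ b} → IsFilter F₀ → b ∉ᶜ F₀ →
                       ∃ λ Δ → IsPrimeFilter Δ × F₀ ⊆ᶜ Δ × b ∉ᶜ Δ
  primeFilterTheorem {F₀} {b} F₀-filter b∉F₀ =
    carrier , (isFilter , maximalFilter-isPrime F ⊔-least) , extends , λ b∈ → avoids b∈ ≤-refl
    where
    F : MaximalFilter F₀ (↓ b)
    F = maximalFilter-below F₀-filter b∉F₀
    open MaximalFilter F

module Theories (lem : ExcludedMiddleω) (zorn : Zornω) {P : Set} (Λ : CondSet) where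
  open Classical lem
  open Deduction {P} Λ

  derivabilityPrelattice : DistributivePrelattice (Form P)
  derivabilityPrelattice = record
    { _≤_          = λ φ ψ → ⊢ φ ⇒ ψ
    ; _⊓_          = _∧_
    ; _⊔_          = _⩒_
    ; ⊤            = ⊤f
    ; ≤-refl       = ⊢-refl _
    ; ≤-trans      = ⊢-trans
    ; x⊓y≤x        = ax-∧E₁
    ; x⊓y≤y        = ax-∧E₂
    ; ⊓-greatest   = λ ⊢χφ ⊢χψ → deduction ⟨ by ⊢χφ #0 , by ⊢χψ #0 ⟩
    ; x≤x⊔y        = ax-⩒I₁
    ; y≤x⊔y        = ax-⩒I₂
    ; ⊔-least      = λ ⊢φχ ⊢ψχ → deduction (case #0 (by ⊢φχ #0) (by ⊢ψχ #0))
    ; ⊓-distribˡ-⊔ = λ _ _ _ → deduction (case (π₂ #0) (ι₁ ⟨ π₁ #1 , #0 ⟩) (ι₂ ⟨ π₁ #1 , #0 ⟩))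
    ; ≤-maximum    = λ φ → ⊢-K φ ⊢⊤
    }

  open PrimeFilters lem zorn derivabilityPrelattice public
    using (IsFilter; IsPrime; MaximalFilter; maximalFilter-below; maximalFilter-isPrime; ↓_; ↑_; ↑-isFilter; a∈↑a)
    renaming (IsPrimeFilter to IsPrimeTheory; primeFilterTheorem to primeTheoryTheorem)

  FormSet : Set
  FormSet = ClassicalSet (Form P)

  IsTheory : FormSet → Set
  IsTheory = IsFilter

  private variable
    φ ψ : Form P

  module _ {S : FormSet} (S-theory : IsTheory S) where
    open IsFilter S-theory

    ⊢∈ : ⊢ φ → φ ∈ᶜ S
    ⊢∈ ⊢φ = ≤-closed (⊢-K ⊤f ⊢φ) ⊤∈

    mp∈ : φ ∈ᶜ S → φ ⇒ ψ ∈ᶜ S → ψ ∈ᶜ S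
    mp∈ φ∈ φ⇒ψ∈ = ≤-closed (deduction (π₁ #0 · π₂ #0)) (⊓-closed φ⇒ψ∈ φ∈)

    ∧∈⁻ : φ ∧ ψ ∈ᶜ S → φ ∈ᶜ S × ψ ∈ᶜ S
    ∧∈⁻ φ∧ψ∈ = ≤-closed (ax-∧E₁ _ _) φ∧ψ∈ , ≤-closed (ax-∧E₂ _ _) φ∧ψ∈

    ⋀-∈ : ∀ {Γ} → All (_∈ᶜ S) Γ → ⋀ Γ ∈ᶜ S
    ⋀-∈ []           = ⊤∈
    ⋀-∈ (φ∈ ∷ Γ⊆S) = ⊓-closed (⋀-∈ Γ⊆S) φ∈

  separation : ¬ (⊢ φ ⇒ ψ) → ∃ λ Δ → IsPrimeTheory Δ × φ ∈ᶜ Δ × ψ ∉ᶜ Δ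
  separation {φ} {ψ} ⊬φ⇒ψ =
    let Δ , Δ-prime , ↑φ⊆Δ , ψ∉Δ =
          primeTheoryTheorem (↑-isFilter φ) λ ψ∈ → ⊬φ⇒ψ (∈-comprehension⁻ (λ x → ⊢ φ ⇒ x) ψ∈)
    in Δ , Δ-prime , ↑φ⊆Δ φ (a∈↑a φ) , ψ∉Δ

  ⊢-fromPrimeTheories : (∀ Δ → IsPrimeTheory Δ → φ ∈ᶜ Δ → ψ ∈ᶜ Δ) → ⊢ φ ⇒ ψ
  ⊢-fromPrimeTheories {φ} {ψ} preserved with lem {A = ⊢ φ ⇒ ψ}
  ... | inj₁ ⊢φ⇒ψ = ⊢φ⇒ψ
  ... | inj₂ ⊬φ⇒ψ = let Δ , Δ-prime , φ∈Δ , ψ∉Δ = separation ⊬φ⇒ψ in ⊥-elim (ψ∉Δ (preserved Δ Δ-prime φ∈Δ))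

  record IsWorld (Γ : FormSet) : Set where
    field
      isTheory   : IsTheory Γ
      isPrime    : IsPrime Γ
      consistent : ⊥f ∉ᶜ Γ
      decides    : ∀ {α} → Declarative α → α ∈ᶜ Γ ⊎ ¬f α ∈ᶜ Γ

  -- Case analysis on β ∨ ¬β, which is sound for declarative conclusions thanks to (DDN).
  declarative-byCases : ∀ {α β f g} → Declarative α →
                        ⊢ f ∧ β ⇒ α → ⊢ g ∧ ¬f β ⇒ α → ⊢ f ∧ g ⇒ α
  declarative-byCases {α} {β} {f} {g} dα ⊢fβα ⊢g¬βα =
    deduction (by (ax-DDN α dα) (ƛ (#0 · by ⊢g¬βα ⟨ π₂ #1 , ¬β ⟩)))
    where
    ¬β : ¬f α ∷ f ∧ g ∷ [] ⊩ ¬f β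
    ¬β = ƛ (#1 · by ⊢fβα ⟨ π₁ #2 , #0 ⟩)

  maximalFilterBelow-decides : ∀ {S α} → Declarative α → (F : MaximalFilter S (↓ α)) → ∀ {β} → Declarative β →
                               β ∈ᶜ MaximalFilter.carrier F ⊎ ¬f β ∈ᶜ MaximalFilter.carrier F
  maximalFilterBelow-decides dα F {β} _ with ∈ᶜ-or-∉ᶜ carrier β | ∈ᶜ-or-∉ᶜ carrier (¬f β)
    where open MaximalFilter F
  ... | inj₁ β∈ | _ = inj₁ β∈
  ... | inj₂ _ | inj₁ ¬β∈ = inj₂ ¬β∈
  ... | inj₂ β∉ | inj₂ ¬β∉ =
    let f , x , f∈ , ⊢xα , ⊢fβx = maximal β∉
        g , y , g∈ , ⊢yα , ⊢g¬βy = maximal ¬β∉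
        ⊢f∧g⇒α = declarative-byCases dα (⊢-trans ⊢fβx ⊢xα) (⊢-trans ⊢g¬βy ⊢yα)
    in ⊥-elim (avoids (≤-closed ⊢f∧g⇒α (⊓-closed f∈ g∈)) (⊢-refl _))
    where
    open MaximalFilter F
    open IsFilter isFilter

  worldExtension : ∀ {S α} → IsTheory S → Declarative α → α ∉ᶜ S →
                   ∃ λ Γ → IsWorld Γ × S ⊆ᶜ Γ × α ∉ᶜ Γ
  worldExtension {S} {α} S-theory dα α∉S = carrier , Γ-world , extends , λ α∈ → avoids α∈ (⊢-refl α)
    where
    F : MaximalFilter S (↓ α)
    F = maximalFilter-below S-theory α∉S
    open MaximalFilter F
    Γ-world : IsWorld carrier
    Γ-world = record
      { isTheory   = isFilter
      ; isPrime    = maximalFilter-isPrime F (DistributivePrelattice.⊔-least derivabilityPrelattice)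
      ; consistent = λ ⊥∈ → avoids ⊥∈ (ax-EFQ α)
      ; decides    = maximalFilterBelow-decides dα F
      }

module Resolutions {P : Set} where

  -- impResolutions L M lists the formulas ⋀_{a ∈ L} (a ⇒ f a), one for each function f : L → M.
  impResolutions : List (Form P) → List (Form P) → List (Form P)
  impResolutions []      M = [ ⊤f ]
  impResolutions (a ∷ L) M = cartesianProductWith _∧_ (map (a ⇒_) M) (impResolutions L M)

  resolutions : Form P → List (Form P)
  resolutions (atom p) = [ atom p ]
  resolutions ⊥f       = [ ⊥f ]
  resolutions (φ ∧ ψ)  = cartesianProductWith _∧_ (resolutions φ) (resolutions ψ)
  resolutions (φ ⇒ ψ)  = impResolutions (resolutions φ) (resolutions ψ)
  resolutions (φ ⩒ ψ)  = resolutions φ ++ resolutions ψ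
  resolutions (φ ⇛ ψ)  = [ φ ⇛ ψ ]

  ⋁ : List (Form P) → Form P
  ⋁ []      = ⊥f
  ⋁ (φ ∷ L) = φ ⩒ ⋁ L

  All-cartesian∧ : ∀ {Q : Form P → Set} → (∀ {φ ψ} → Q φ → Q ψ → Q (φ ∧ ψ)) →
                   ∀ {L M} → All Q L → All Q M → All Q (cartesianProductWith _∧_ L M)
  All-cartesian∧ Q-∧ {L} {M} QL QM =
    All.cartesianProductWith⁺ (setoid _) (setoid _) _∧_ L M λ φ∈ ψ∈ → Q-∧ (All.lookup QL φ∈) (All.lookup QM ψ∈)

  impResolutions-declarative : ∀ {L M} → All Declarative L → All Declarative M →
                               All Declarative (impResolutions L M)
  impResolutions-declarative []        dM = d-⇒ d-⊥ d-⊥ ∷ []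
  impResolutions-declarative (da ∷ dL) dM =
    All-cartesian∧ d-∧ (All.map⁺ (All.map (d-⇒ da) dM)) (impResolutions-declarative dL dM)

  resolutions-declarative : ∀ φ → All Declarative (resolutions φ)
  resolutions-declarative (atom p) = d-atom p ∷ []
  resolutions-declarative ⊥f       = d-⊥ ∷ []
  resolutions-declarative (φ ∧ ψ)  = All-cartesian∧ d-∧ (resolutions-declarative φ) (resolutions-declarative ψ)
  resolutions-declarative (φ ⇒ ψ)  =
    impResolutions-declarative (resolutions-declarative φ) (resolutions-declarative ψ)
  resolutions-declarative (φ ⩒ ψ)  = All.++⁺ (resolutions-declarative φ) (resolutions-declarative ψ)
  resolutions-declarative (φ ⇛ ψ)  = d-⇛ φ ψ ∷ []

  impResolutions-nonempty : ∀ L {M} → Any (λ _ → Unit) M → Any (λ _ → Unit) (impResolutions L M)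
  impResolutions-nonempty []      _     = here tt
  impResolutions-nonempty (a ∷ L) M≠[] =
    Any.cartesianProductWith⁺ _∧_ _ (Any.map⁺ {P = λ _ → Unit} M≠[]) (impResolutions-nonempty L M≠[])

  resolutions-nonempty : ∀ φ → Any (λ _ → Unit) (resolutions φ)
  resolutions-nonempty (atom p) = here tt
  resolutions-nonempty ⊥f       = here tt
  resolutions-nonempty (φ ∧ ψ)  =
    Any.cartesianProductWith⁺ _∧_ _ (resolutions-nonempty φ) (resolutions-nonempty ψ)
  resolutions-nonempty (φ ⇒ ψ)  = impResolutions-nonempty (resolutions φ) (resolutions-nonempty ψ)
  resolutions-nonempty (φ ⩒ ψ)  = Any.++⁺ˡ (resolutions-nonempty φ)
  resolutions-nonempty (φ ⇛ ψ)  = here tt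

  declarative-singleResolution : ∀ {α} → Declarative α → ∃ λ α′ → resolutions α ≡ [ α′ ]
  declarative-singleResolution (d-atom p) = _ , refl
  declarative-singleResolution d-⊥ = _ , refl
  declarative-singleResolution (d-⇛ φ ψ) = _ , refl
  declarative-singleResolution (d-∧ {φ} {ψ} dφ dψ)
    with resolutions φ | declarative-singleResolution dφ | resolutions ψ | declarative-singleResolution dψ
  ... | _ | (a , refl) | _ | (b , refl) = a ∧ b , refl
  declarative-singleResolution (d-⇒ {φ} {ψ} dφ dψ)
    with resolutions φ | declarative-singleResolution dφ | resolutions ψ | declarative-singleResolution dψ
  ... | _ | (a , refl) | _ | (b , refl) = (a ⇒ b) ∧ ⊤f , refl

  module _ {Q : Form P → Set} where

    Any-impResolutions⁻ : (∀ {φ ψ} → Q (φ ∧ ψ) → Q φ × Q ψ) → ∀ L M →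
                          Any Q (impResolutions L M) → All (λ a → Any (λ b → Q (a ⇒ b)) M) L
    Any-impResolutions⁻ Q-∧⁻ []      M _ = []
    Any-impResolutions⁻ Q-∧⁻ (a ∷ L) M any =
      let any-a , any-L = Any.cartesianProductWith⁻ _∧_ Q-∧⁻ (map (a ⇒_) M) (impResolutions L M) any
      in Any.map⁻ any-a ∷ Any-impResolutions⁻ Q-∧⁻ L M any-L

    Any-impResolutions⁺ : Q ⊤f → (∀ {φ ψ} → Q φ → Q ψ → Q (φ ∧ ψ)) → ∀ {L M} →
                          All (λ a → Any (λ b → Q (a ⇒ b)) M) L → Any Q (impResolutions L M)
    Any-impResolutions⁺ Q-⊤ Q-∧ []         = here Q-⊤
    Any-impResolutions⁺ Q-⊤ Q-∧ (any-a ∷ all) =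
      Any.cartesianProductWith⁺ _∧_ Q-∧ (Any.map⁺ any-a) (Any-impResolutions⁺ Q-⊤ Q-∧ all)

    Any-mp : (∀ {φ ψ} → Q φ → Q (φ ⇒ ψ) → Q ψ) → ∀ {L M} →
             All (λ a → Any (λ b → Q (a ⇒ b)) M) L → Any Q L → Any Q M
    Any-mp Q-mp = All.lookupWith λ any-b Qa → Any.map (Q-mp Qa) any-b

    module _ (Q-⩒ : ∀ {φ ψ} → Q (φ ⩒ ψ) → Q φ ⊎ Q ψ) where

      ⋁-split : ∀ L → Q (⋁ L) → Any Q L ⊎ Q ⊥f
      ⋁-split []      Q⊥ = inj₂ Q⊥
      ⋁-split (φ ∷ L) Q⋁ with Q-⩒ Q⋁
      ... | inj₁ Qφ  = inj₁ (here Qφ)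
      ... | inj₂ Q⋁L = Sum.map₁ there (⋁-split L Q⋁L)

      Any-⋁ : (Q ⊥f → ∀ {φ} → Q φ) → ∀ L → Any (λ _ → Unit) L → Q (⋁ L) → Any Q L
      Any-⋁ Q-⊥ L nonempty Q⋁ with ⋁-split L Q⋁
      ... | inj₁ any = any
      ... | inj₂ Q⊥  = Any.map (λ _ → Q-⊥ Q⊥) nonempty

module ResolutionLemma (lem : ExcludedMiddleω) (zorn : Zornω) {P : Set} (Λ : CondSet) where
  open Classical lem
  open Deduction {P} Λ
  open Theories lem zorn {P} Λ
  open Resolutions {P}

  ResolutionProperty : Form P → Set
  ResolutionProperty χ = ∀ Δ → IsPrimeTheory Δ → (χ ∈ᶜ Δ) ⇔ Any (_∈ᶜ Δ) (resolutions χ)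

  module _ {Δ : FormSet} (Δ-theory : IsTheory Δ) where
    open IsFilter Δ-theory

    entailed-∈ : ∀ {χ L} → All (λ α → ⊢ α ⇒ χ) L → Any (_∈ᶜ Δ) L → χ ∈ᶜ Δ
    entailed-∈ = All.lookupWith ≤-closed

    ⋁-∈ : ∀ {L} → Any (_∈ᶜ Δ) L → ⋁ L ∈ᶜ Δ
    ⋁-∈ (here φ∈)   = ≤-closed (ax-⩒I₁ _ _) φ∈
    ⋁-∈ (there any) = ≤-closed (ax-⩒I₂ _ _) (⋁-∈ any)

  ⋁-least : ∀ {χ L} → All (λ a → ⊢ a ⇒ χ) L → ⊢ ⋁ L ⇒ χ
  ⋁-least []           = ax-EFQ _
  ⋁-least (⊢aχ ∷ ⊢Lχ) = DistributivePrelattice.⊔-least derivabilityPrelattice ⊢aχ (⋁-least ⊢Lχ)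

  module _ {χ : Form P} (RP : ResolutionProperty χ) where

    resolutions-entail : All (λ α → ⊢ α ⇒ χ) (resolutions χ)
    resolutions-entail = All.tabulate λ α∈ →
      ⊢-fromPrimeTheories λ Δ Δ-prime α∈Δ → Equivalence.from (RP Δ Δ-prime) (lose α∈ α∈Δ)

    entails-⋁resolutions : ⊢ χ ⇒ ⋁ (resolutions χ)
    entails-⋁resolutions =
      ⊢-fromPrimeTheories λ Δ Δ-prime χ∈Δ → ⋁-∈ (proj₁ Δ-prime) (Equivalence.to (RP Δ Δ-prime) χ∈Δ)

  module _ {φ ψ : Form P} (RPφ : ResolutionProperty φ) (RPψ : ResolutionProperty ψ) where

    ∧-resolutionProperty : ResolutionProperty (φ ∧ ψ)
    ∧-resolutionProperty Δ Δ-prime@(Δ-theory , _) = mk⇔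
      (λ φ∧ψ∈ → let φ∈ , ψ∈ = ∧∈⁻ Δ-theory φ∧ψ∈ in
                Any.cartesianProductWith⁺ _∧_ ⊓-closed (Equivalence.to (RPφ Δ Δ-prime) φ∈)
                                                       (Equivalence.to (RPψ Δ Δ-prime) ψ∈))
      (λ any → let anyφ , anyψ = Any.cartesianProductWith⁻ _∧_ (∧∈⁻ Δ-theory) _ _ any in
               ⊓-closed (Equivalence.from (RPφ Δ Δ-prime) anyφ) (Equivalence.from (RPψ Δ Δ-prime) anyψ))
      where open IsFilter Δ-theory

    ⩒-resolutionProperty : ResolutionProperty (φ ⩒ ψ)
    ⩒-resolutionProperty Δ Δ-prime@(Δ-theory , Δ-isPrime) = mk⇔ to from
      where
      open IsFilter Δ-theory
      to : φ ⩒ ψ ∈ᶜ Δ → Any (_∈ᶜ Δ) (resolutions (φ ⩒ ψ))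
      to φ⩒ψ∈ with Δ-isPrime φ⩒ψ∈
      ... | inj₁ φ∈ = Any.++⁺ˡ (Equivalence.to (RPφ Δ Δ-prime) φ∈)
      ... | inj₂ ψ∈ = Any.++⁺ʳ _ (Equivalence.to (RPψ Δ Δ-prime) ψ∈)
      from : Any (_∈ᶜ Δ) (resolutions (φ ⩒ ψ)) → φ ⩒ ψ ∈ᶜ Δ
      from any with Any.++⁻ _ any
      ... | inj₁ anyφ = ≤-closed (ax-⩒I₁ _ _) (Equivalence.from (RPφ Δ Δ-prime) anyφ)
      ... | inj₂ anyψ = ≤-closed (ax-⩒I₂ _ _) (Equivalence.from (RPψ Δ Δ-prime) anyψ)

    impResolutions-entail : All (λ γ → ⊢ γ ⇒ φ ⇒ ψ) (resolutions (φ ⇒ ψ))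
    impResolutions-entail = All.tabulate λ {γ} γ∈ → ⊢-curry (⊢-fromPrimeTheories λ where
      Δ Δ-prime@(Δ-theory , _) γ∧φ∈ →
        let γ∈Δ , φ∈Δ = ∧∈⁻ Δ-theory γ∧φ∈
        in Equivalence.from (RPψ Δ Δ-prime)
             (Any-mp (mp∈ Δ-theory)
                (Any-impResolutions⁻ {Q = _∈ᶜ Δ} (∧∈⁻ Δ-theory) (resolutions φ) (resolutions ψ) (lose γ∈ γ∈Δ))
                (Equivalence.to (RPφ Δ Δ-prime) φ∈Δ)))

    -- Since every resolution a of φ is declarative, (Split) lets a ⇒ ⋁ (resolutions ψ) choose a disjunct.
    ⇒-resolutionProperty : ResolutionProperty (φ ⇒ ψ)
    ⇒-resolutionProperty Δ Δ-prime@(Δ-theory , Δ-isPrime) =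
      mk⇔ to (entailed-∈ Δ-theory impResolutions-entail)
      where
      open IsFilter Δ-theory
      to : φ ⇒ ψ ∈ᶜ Δ → Any (_∈ᶜ Δ) (resolutions (φ ⇒ ψ))
      to φ⇒ψ∈ = Any-impResolutions⁺ ⊤∈ ⊓-closed
        (All.zipWith choose (resolutions-declarative φ , resolutions-entail RPφ))
        where
        choose : ∀ {a} → Declarative a × ⊢ a ⇒ φ → Any (λ b → a ⇒ b ∈ᶜ Δ) (resolutions ψ)
        choose {a} (da , ⊢aφ) = Any-⋁ split efq-∈ (resolutions ψ) (resolutions-nonempty ψ)
          (≤-closed (deduction (ƛ by (entails-⋁resolutions RPψ) (#1 · by ⊢aφ #0))) φ⇒ψ∈)
          where
          split : ∀ {b c} → a ⇒ b ⩒ c ∈ᶜ Δ → a ⇒ b ∈ᶜ Δ ⊎ a ⇒ c ∈ᶜ Δ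
          split a⇒b⩒c∈ = Δ-isPrime (≤-closed (ax-Split a _ _ da) a⇒b⩒c∈)
          efq-∈ : a ⇒ ⊥f ∈ᶜ Δ → ∀ {b} → a ⇒ b ∈ᶜ Δ
          efq-∈ a⇒⊥∈ = ≤-closed (deduction (ƛ efq (#1 · #0))) a⇒⊥∈

  resolutionProperty : ∀ χ → ResolutionProperty χ
  resolutionProperty (atom p) Δ _ = mk⇔ here Any.singleton⁻
  resolutionProperty ⊥f       Δ _ = mk⇔ here Any.singleton⁻
  resolutionProperty (φ ⇛ ψ)  Δ _ = mk⇔ here Any.singleton⁻
  resolutionProperty (φ ∧ ψ)  = ∧-resolutionProperty (resolutionProperty φ) (resolutionProperty ψ)
  resolutionProperty (φ ⩒ ψ)  = ⩒-resolutionProperty (resolutionProperty φ) (resolutionProperty ψ)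
  resolutionProperty (φ ⇒ ψ)  = ⇒-resolutionProperty (resolutionProperty φ) (resolutionProperty ψ)

  resolution⇒formula : ∀ χ → All (λ α → ⊢ α ⇒ χ) (resolutions χ)
  resolution⇒formula χ = resolutions-entail (resolutionProperty χ)

  formula⇒⋁resolutions : ∀ χ → ⊢ χ ⇒ ⋁ (resolutions χ)
  formula⇒⋁resolutions χ = entails-⋁resolutions (resolutionProperty χ)

module CanonicalModel (lem : ExcludedMiddleω) (zorn : Zornω) {P : Set} (Λ : CondSet) where
  open Classical lem
  open Deduction {P} Λ
  open Theories lem zorn {P} Λ
    hiding (MaximalFilter; maximalFilter-below; maximalFilter-isPrime; ↓_; ↑_; ↑-isFilter; a∈↑a)
  open Resolutions {P}
  open ResolutionLemma lem zorn {P} Λ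
  open Equivalence using (to; from)

  World : Set
  World = Σ FormSet IsWorld

  infix 2.5 _∈ʷ_ _⊫_ _⊨ʳ_

  _∈ʷ_ : Form P → World → Set
  φ ∈ʷ Γ = φ ∈ᶜ proj₁ Γ

  private variable
    φ ψ χ α β : Form P
    s t : Pred World

  world-theory : (Γ : World) → IsTheory (proj₁ Γ)
  world-theory Γ = IsWorld.isTheory (proj₂ Γ)

  world-primeTheory : (Γ : World) → IsPrimeTheory (proj₁ Γ)
  world-primeTheory Γ = IsWorld.isTheory (proj₂ Γ) , IsWorld.isPrime (proj₂ Γ)

  ¬-∈ʷ : ∀ Γ → ¬f φ ∈ʷ Γ → ¬ (φ ∈ʷ Γ)
  ¬-∈ʷ Γ ¬φ∈ φ∈ = IsWorld.consistent (proj₂ Γ) (mp∈ (world-theory Γ) φ∈ ¬φ∈)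

  declarative-⇒-∈ʷ : ∀ Γ → Declarative α → (α ∈ʷ Γ → ψ ∈ʷ Γ) → α ⇒ ψ ∈ʷ Γ
  declarative-⇒-∈ʷ {α} {ψ} Γ dα α→ψ with IsWorld.decides (proj₂ Γ) dα
  ... | inj₁ α∈  = IsFilter.≤-closed (world-theory Γ) (ax-K ψ α) (α→ψ α∈)
  ... | inj₂ ¬α∈ = IsFilter.≤-closed (world-theory Γ) (deduction (ƛ efq (#1 · #0))) ¬α∈

  ∨-∈ʷ : ∀ Γ → Declarative α → Declarative β → α ∨f β ∈ʷ Γ → α ∈ʷ Γ ⊎ β ∈ʷ Γ
  ∨-∈ʷ Γ dα dβ α∨β∈ with IsWorld.decides (proj₂ Γ) dα | IsWorld.decides (proj₂ Γ) dβ
  ... | inj₁ α∈ | _ = inj₁ α∈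
  ... | inj₂ _ | inj₁ β∈ = inj₂ β∈
  ... | inj₂ ¬α∈ | inj₂ ¬β∈ = ⊥-elim (¬-∈ʷ Γ α∨β∈ (IsFilter.⊓-closed (world-theory Γ) ¬α∈ ¬β∈))

  _⊫_ : Pred World → Form P → Set
  s ⊫ α = ∀ Γ → s Γ → α ∈ʷ Γ

  -- truthLemma identifies this with support in the canonical model.
  _⊨ʳ_ : Pred World → Form P → Set
  s ⊨ʳ φ = Any (s ⊫_) (resolutions φ)

  ⊫-∧⁻ : s ⊫ φ ∧ ψ → s ⊫ φ × s ⊫ ψ
  ⊫-∧⁻ h = (λ Γ sΓ → proj₁ (∧∈⁻ (world-theory Γ) (h Γ sΓ))) , (λ Γ sΓ → proj₂ (∧∈⁻ (world-theory Γ) (h Γ sΓ)))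

  ⊫-∧⁺ : s ⊫ φ → s ⊫ ψ → s ⊫ φ ∧ ψ
  ⊫-∧⁺ hφ hψ Γ sΓ = IsFilter.⊓-closed (world-theory Γ) (hφ Γ sΓ) (hψ Γ sΓ)

  ⊫-⊤ : s ⊫ ⊤f
  ⊫-⊤ Γ _ = IsFilter.⊤∈ (world-theory Γ)

  ⊫-mp : s ⊫ φ → s ⊫ φ ⇒ ψ → s ⊫ ψ
  ⊫-mp hφ hφψ Γ sΓ = mp∈ (world-theory Γ) (hφ Γ sΓ) (hφψ Γ sΓ)

  ⊨ʳ-anti-mono : t ⊆ s → s ⊨ʳ φ → t ⊨ʳ φ
  ⊨ʳ-anti-mono t⊆s = Any.map λ h Γ tΓ → h Γ (t⊆s Γ tΓ)

  ⊨ʳ-⇒⁻ : s ⊨ʳ φ ⇒ ψ → t ⊆ s → t ⊨ʳ φ → t ⊨ʳ ψ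
  ⊨ʳ-⇒⁻ {φ = φ} {ψ = ψ} s⊨φ⇒ψ t⊆s =
    Any-mp ⊫-mp (Any-impResolutions⁻ ⊫-∧⁻ (resolutions φ) (resolutions ψ) (⊨ʳ-anti-mono {φ = φ ⇒ ψ} t⊆s s⊨φ⇒ψ))

  ⊨ʳ-⇒⁺ : (∀ t → t ⊆ s → t ⊨ʳ φ → t ⊨ʳ ψ) → s ⊨ʳ φ ⇒ ψ
  ⊨ʳ-⇒⁺ {s} {φ} {ψ} h = Any-impResolutions⁺ ⊫-⊤ ⊫-∧⁺ (All.tabulate choose)
    where
    choose : ∀ {a} → a ∈ resolutions φ → Any (λ b → s ⊫ a ⇒ b) (resolutions ψ)
    choose {a} a∈ = Any.map
      (λ s∩a⊫b Γ sΓ → declarative-⇒-∈ʷ Γ (All.lookup (resolutions-declarative φ) a∈) λ a∈Γ → s∩a⊫b Γ (sΓ , a∈Γ))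
      (h (λ Γ → s Γ × a ∈ʷ Γ) (λ _ → proj₁) (lose a∈ λ _ → proj₂))

  ⊨ʳ-⊤ : s ⊨ʳ ⊤f
  ⊨ʳ-⊤ = ⊨ʳ-⇒⁺ {φ = ⊥f} {ψ = ⊥f} λ _ _ t⊨⊥ → t⊨⊥

  ⊨ʳ⇒⊫ : s ⊨ʳ χ → s ⊫ χ
  ⊨ʳ⇒⊫ {χ = χ} s⊨χ Γ sΓ =
    entailed-∈ (world-theory Γ) (resolution⇒formula χ) (Any.map (λ h → h Γ sΓ) s⊨χ)

  ⊫⇒⊨ʳ : Declarative α → s ⊫ α → s ⊨ʳ α
  ⊫⇒⊨ʳ {α} dα s⊫α with resolutions α | declarative-singleResolution dα | resolutionProperty α
  ... | _ | _ , refl | RP = here λ Γ sΓ → Any.singleton⁻ (to (RP (proj₁ Γ) (world-primeTheory Γ)) (s⊫α Γ sΓ))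

  extensions : FormSet → Pred World
  extensions S Γ = S ⊆ᶜ proj₁ Γ

  extensions-⊫ : ∀ {S} → IsTheory S → Declarative α → extensions S ⊫ α → α ∈ᶜ S
  extensions-⊫ {α} {S} S-theory dα S⊫α with ∈ᶜ-or-∉ᶜ S α
  ... | inj₁ α∈S = α∈S
  ... | inj₂ α∉S = let Γ , Γ-world , S⊆Γ , α∉Γ = worldExtension S-theory dα α∉S
                   in ⊥-elim (α∉Γ (S⊫α (Γ , Γ-world) S⊆Γ))

  ∈⇔extensions⊨ʳ : ∀ {S} → IsPrimeTheory S → (χ ∈ᶜ S) ⇔ (extensions S ⊨ʳ χ)
  ∈⇔extensions⊨ʳ {χ} {S} S-prime@(S-theory , _) = mk⇔
    (λ χ∈S → Any.map (λ a∈S Γ S⊆Γ → S⊆Γ _ a∈S) (to (resolutionProperty χ S S-prime) χ∈S))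
    (λ S⊨χ → let α , α∈ , S⊫α = find S⊨χ in
             IsFilter.≤-closed S-theory (All.lookup (resolution⇒formula χ) α∈)
                                         (extensions-⊫ S-theory (All.lookup (resolutions-declarative χ) α∈) S⊫α))

  Σᶜ : World → Pred World → Set
  Σᶜ Γ t = Nonempty t × (∀ φ ψ → φ ⇛ ψ ∈ʷ Γ → t ⊨ʳ φ → t ⊨ʳ ψ)

  Σᶜ-ext : ∀ Γ t t′ → t ⊆ t′ → t′ ⊆ t → Σᶜ Γ t → Σᶜ Γ t′
  Σᶜ-ext Γ t t′ t⊆t′ t′⊆t ((v , tv) , closure) =
    (v , t⊆t′ v tv) ,
    λ φ ψ φ⇛ψ∈ t′⊨φ → ⊨ʳ-anti-mono {φ = ψ} t′⊆t (closure φ ψ φ⇛ψ∈ (⊨ʳ-anti-mono {φ = φ} t⊆t′ t′⊨φ))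

  ⊢⇒-⇛∈ʷ : ∀ Γ → ⊢ φ ⇒ ψ → φ ⇛ ψ ∈ʷ Γ
  ⊢⇒-⇛∈ʷ Γ ⊢φψ = ⊢∈ (world-theory Γ) (cn ⊢φψ)

  -- By (Trans), (RConj) and (LDisj), the conditionals of a world order formulas as a distributive prelattice.
  conditionalPrelattice : World → DistributivePrelattice (Form P)
  conditionalPrelattice Γ = record
    { _≤_          = λ φ ψ → φ ⇛ ψ ∈ʷ Γ
    ; _⊓_          = _∧_
    ; _⊔_          = _⩒_
    ; ⊤            = ⊤f
    ; ≤-refl       = ⊢⇒-⇛∈ʷ Γ (⊢-refl _)
    ; ≤-trans      = λ φ⇛ψ∈ ψ⇛χ∈ → ≤-closed (ax-Trans _ _ _) (⊓-closed φ⇛ψ∈ ψ⇛χ∈)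
    ; x⊓y≤x        = λ φ ψ → ⊢⇒-⇛∈ʷ Γ (ax-∧E₁ φ ψ)
    ; x⊓y≤y        = λ φ ψ → ⊢⇒-⇛∈ʷ Γ (ax-∧E₂ φ ψ)
    ; ⊓-greatest   = λ χ⇛φ∈ χ⇛ψ∈ → ≤-closed (ax-RConj _ _ _) (⊓-closed χ⇛φ∈ χ⇛ψ∈)
    ; x≤x⊔y        = λ φ ψ → ⊢⇒-⇛∈ʷ Γ (ax-⩒I₁ φ ψ)
    ; y≤x⊔y        = λ φ ψ → ⊢⇒-⇛∈ʷ Γ (ax-⩒I₂ φ ψ)
    ; ⊔-least      = λ φ⇛χ∈ ψ⇛χ∈ → ≤-closed (ax-LDisj _ _ _) (⊓-closed φ⇛χ∈ ψ⇛χ∈)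
    ; ⊓-distribˡ-⊔ = λ φ ψ χ → ⊢⇒-⇛∈ʷ Γ (DistributivePrelattice.⊓-distribˡ-⊔ derivabilityPrelattice φ ψ χ)
    ; ≤-maximum    = λ φ → ⊢⇒-⇛∈ʷ Γ (⊢-K φ ⊢⊤)
    }
    where open IsFilter (world-theory Γ)

  module Conditional (Γ : World) = PrimeFilters lem zorn (conditionalPrelattice Γ)

  conditionalFilter-isTheory : ∀ Γ {S} → Conditional.IsFilter Γ S → IsTheory S
  conditionalFilter-isTheory Γ S-filter = record
    { ⊤∈       = ⊤∈
    ; ⊓-closed = ⊓-closed
    ; ≤-closed = λ ⊢φψ → ≤-closed (⊢⇒-⇛∈ʷ Γ ⊢φψ)
    }
    where open Conditional.IsFilter Γ S-filter

  primeConditionalFilter-Σᶜ : ∀ Γ {S} → Conditional.IsPrimeFilter Γ S → ⊥f ∉ᶜ S → Σᶜ Γ (extensions S)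
  primeConditionalFilter-Σᶜ Γ {S} (S-filter , S-isPrime) ⊥∉S = nonempty , closure
    where
    S-prime : IsPrimeTheory S
    S-prime = conditionalFilter-isTheory Γ S-filter , S-isPrime
    nonempty : Nonempty (extensions S)
    nonempty = let Δ , Δ-world , S⊆Δ , _ = worldExtension (proj₁ S-prime) d-⊥ ⊥∉S in (Δ , Δ-world) , S⊆Δ
    closure : ∀ φ ψ → φ ⇛ ψ ∈ʷ Γ → extensions S ⊨ʳ φ → extensions S ⊨ʳ ψ
    closure φ ψ φ⇛ψ∈ S⊨φ =
      to (∈⇔extensions⊨ʳ S-prime)
         (Conditional.IsFilter.≤-closed {Γ} S-filter φ⇛ψ∈ (from (∈⇔extensions⊨ʳ S-prime) S⊨φ))

  ⇛-counterexample : ∀ Γ → φ ⇛ ψ ∉ᶜ proj₁ Γ → ∃ λ t → Σᶜ Γ t × t ⊨ʳ φ × ¬ (t ⊨ʳ ψ)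
  ⇛-counterexample {φ} {ψ} Γ φ⇛ψ∉Γ =
    let Δ , Δ-primeFilter@(Δ-filter , Δ-isPrime) , ↑φ⊆Δ , ψ∉Δ =
          Conditional.primeFilterTheorem Γ (Conditional.↑-isFilter Γ φ) ψ∉↑φ
        Δ-prime : IsPrimeTheory Δ
        Δ-prime = conditionalFilter-isTheory Γ Δ-filter , Δ-isPrime
        ⊥∉Δ : ⊥f ∉ᶜ Δ
        ⊥∉Δ ⊥∈Δ = ψ∉Δ (Conditional.IsFilter.≤-closed {Γ} Δ-filter (⊢⇒-⇛∈ʷ Γ (ax-EFQ ψ)) ⊥∈Δ)
    in extensions Δ , primeConditionalFilter-Σᶜ Γ Δ-primeFilter ⊥∉Δ ,
       to (∈⇔extensions⊨ʳ Δ-prime) (↑φ⊆Δ φ (Conditional.a∈↑a Γ φ)) ,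
       λ Δ⊨ψ → ψ∉Δ (from (∈⇔extensions⊨ʳ Δ-prime) Δ⊨ψ)
    where
    ψ∉↑φ : ψ ∉ᶜ Conditional.↑_ Γ φ
    ψ∉↑φ ψ∈↑φ = φ⇛ψ∉Γ (∈-comprehension⁻ (λ x → φ ⇛ x ∈ʷ Γ) ψ∈↑φ)

  Σᶜ-⇛ : ∀ Γ → (∀ t → Σᶜ Γ t → t ⊨ʳ φ → t ⊨ʳ ψ) → φ ⇛ ψ ∈ʷ Γ
  Σᶜ-⇛ {φ} {ψ} Γ closure with ∈ᶜ-or-∉ᶜ (proj₁ Γ) (φ ⇛ ψ)
  ... | inj₁ φ⇛ψ∈ = φ⇛ψ∈
  ... | inj₂ φ⇛ψ∉ = let t , σt , t⊨φ , t⊭ψ = ⇛-counterexample Γ φ⇛ψ∉ in ⊥-elim (t⊭ψ (closure t σt t⊨φ))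

  Λ-axiom-mp : ∀ Γ {c} → Λ c ≡ true → CondAxiom c (φ ⇒ ψ) → φ ∈ʷ Γ → ψ ∈ʷ Γ
  Λ-axiom-mp Γ c∈Λ ax φ∈ = mp∈ (world-theory Γ) φ∈ (⊢∈ (world-theory Γ) (ax-Λ _ _ c∈Λ ax))

  ⊞-⊨ʳ : ∀ Γ {u} → ⊞ φ ∈ʷ Γ → Σᶜ Γ u → u ⊨ʳ φ
  ⊞-⊨ʳ Γ ⊞φ∈ (_ , closure) = closure ⊤f _ ⊞φ∈ ⊨ʳ-⊤

  ⇛-trans : ∀ Γ → φ ⇛ ψ ∈ʷ Γ → ψ ⇛ χ ∈ʷ Γ → φ ⇛ χ ∈ʷ Γ
  ⇛-trans Γ = DistributivePrelattice.≤-trans (conditionalPrelattice Γ)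

  -- If χ ∉ Γ, then Γ refutes every resolution of χ and hence the declarative δ entailed by χ;
  -- but ⊞ χ ∈ Γ gives ⊞ δ ∈ Γ, and then δ ∈ Γ by the axiom of reflexivity.
  ⊞-elim-∈ʷ : Λ reflexive ≡ true → ∀ Γ → ⊞ χ ∈ʷ Γ → χ ∈ʷ Γ
  ⊞-elim-∈ʷ {χ} on Γ ⊞χ∈ with ∈ᶜ-or-∉ᶜ (proj₁ Γ) χ
  ... | inj₁ χ∈ = χ∈
  ... | inj₂ χ∉ = ⊥-elim (¬-∈ʷ Γ δ∈ (⋀-∈ (world-theory Γ) (All.map⁺ (All.tabulate refuted))))
    where
    negations : List (Form P)
    negations = map ¬f_ (resolutions χ)
    δ : Form P
    δ = ¬f ⋀ negations
    refuted : ∀ {a} → a ∈ resolutions χ → ¬f a ∈ʷ Γ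
    refuted a∈ with IsWorld.decides (proj₂ Γ) (All.lookup (resolutions-declarative χ) a∈)
    ... | inj₂ ¬a∈Γ = ¬a∈Γ
    ... | inj₁ a∈Γ  = ⊥-elim (χ∉ (IsFilter.≤-closed (world-theory Γ) (All.lookup (resolution⇒formula χ) a∈) a∈Γ))
    ⊢χδ : ⊢ χ ⇒ δ
    ⊢χδ = ⊢-trans (formula⇒⋁resolutions χ)
                  (⋁-least (All.tabulate λ a∈ → deduction (ƛ (by (hypothesis (∈-map⁺ ¬f_ a∈)) #0 · #1))))
    dδ : Declarative δ
    dδ = d-⇒ (⋀-declarative (All.map⁺ (All.map (λ da → d-⇒ da d-⊥) (resolutions-declarative χ)))) d-⊥
    δ∈ : δ ∈ʷ Γ
    δ∈ = Λ-axiom-mp Γ on (ax-reflexive δ dδ) (⇛-trans Γ ⊞χ∈ (⊢⇒-⇛∈ʷ Γ ⊢χδ))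

  resolution-⇛-⋁ : ∀ Γ {a} → φ ⇛ ψ ∈ʷ Γ → a ∈ resolutions φ → a ⇛ ⋁ (resolutions ψ) ∈ʷ Γ
  resolution-⇛-⋁ {φ} {ψ} Γ φ⇛ψ∈ a∈ =
    ⇛-trans Γ (⊢⇒-⇛∈ʷ Γ (All.lookup (resolution⇒formula φ) a∈))
              (⇛-trans Γ φ⇛ψ∈ (⊢⇒-⇛∈ʷ Γ (formula⇒⋁resolutions ψ)))

  unionClosed-choice : Λ unionClosed ≡ true → ∀ Γ → Declarative α → ∀ L → Any (λ _ → Unit) L →
                       α ⇛ ⋁ L ∈ʷ Γ → Any (λ b → α ⇛ b ∈ʷ Γ) L
  unionClosed-choice {α} on Γ dα = Any-⋁ split efq-⇛
    where
    split : ∀ {b c} → α ⇛ b ⩒ c ∈ʷ Γ → α ⇛ b ∈ʷ Γ ⊎ α ⇛ c ∈ʷ Γ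
    split {b} {c} α⇛b⩒c∈ = ∨-∈ʷ Γ (d-⇛ α b) (d-⇛ α c) (Λ-axiom-mp Γ on (ax-unionClosed α b c dα) α⇛b⩒c∈)
    efq-⇛ : α ⇛ ⊥f ∈ʷ Γ → ∀ {b} → α ⇛ b ∈ʷ Γ
    efq-⇛ α⇛⊥∈ = ⇛-trans Γ α⇛⊥∈ (⊢⇒-⇛∈ʷ Γ (ax-EFQ _))

  canonicalModel : World → InModel P lzero
  canonicalModel Γ₀ = record
    { W      = World
    ; world  = Γ₀
    ; Sg     = Σᶜ
    ; Sg-ne  = λ _ _ → proj₁
    ; Sg-ext = Σᶜ-ext
    ; V      = λ Γ p → proj₁ Γ (atom p)
    }

  module _ {Γ₀ : World} where
    private
      M : InModel P lzero
      M = canonicalModel Γ₀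

    truthLemma : ∀ φ s → (_⊨_ M s φ) ⇔ (s ⊨ʳ φ)
    truthLemma (atom p) s = mk⇔
      (λ s⊨p → here λ Γ sΓ → from T-≡ (lower s⊨p Γ sΓ))
      (λ s⊨ʳp → lift λ Γ sΓ → to T-≡ (Any.singleton⁻ s⊨ʳp Γ sΓ))
    truthLemma ⊥f s = mk⇔
      (λ s⊨⊥ → here λ Γ sΓ → ⊥-elim (lower s⊨⊥ Γ sΓ))
      (λ s⊨ʳ⊥ → lift λ Γ sΓ → IsWorld.consistent (proj₂ Γ) (Any.singleton⁻ s⊨ʳ⊥ Γ sΓ))
    truthLemma (φ ∧ ψ) s = mk⇔
      (λ (s⊨φ , s⊨ψ) → Any.cartesianProductWith⁺ _∧_ ⊫-∧⁺ (to (truthLemma φ s) s⊨φ) (to (truthLemma ψ s) s⊨ψ))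
      (λ s⊨ʳφ∧ψ → let s⊨ʳφ , s⊨ʳψ = Any.cartesianProductWith⁻ _∧_ ⊫-∧⁻ _ _ s⊨ʳφ∧ψ
                   in from (truthLemma φ s) s⊨ʳφ , from (truthLemma ψ s) s⊨ʳψ)
    truthLemma (φ ⩒ ψ) s = mk⇔
      (Sum.[ (λ s⊨φ → Any.++⁺ˡ (to (truthLemma φ s) s⊨φ)) , (λ s⊨ψ → Any.++⁺ʳ _ (to (truthLemma ψ s) s⊨ψ)) ])
      (λ s⊨ʳφ⩒ψ → Sum.map (from (truthLemma φ s)) (from (truthLemma ψ s)) (Any.++⁻ _ s⊨ʳφ⩒ψ))
    truthLemma (φ ⇒ ψ) s = mk⇔
      (λ s⊨φ⇒ψ → ⊨ʳ-⇒⁺ {φ = φ} {ψ = ψ} λ t t⊆s t⊨ʳφ →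
        to (truthLemma ψ t) (s⊨φ⇒ψ t t⊆s (from (truthLemma φ t) t⊨ʳφ)))
      (λ s⊨ʳφ⇒ψ t t⊆s t⊨φ → from (truthLemma ψ t) (⊨ʳ-⇒⁻ {φ = φ} {ψ = ψ} s⊨ʳφ⇒ψ t⊆s (to (truthLemma φ t) t⊨φ)))
    truthLemma (φ ⇛ ψ) s = mk⇔
      (λ s⊨φ⇛ψ → here λ Γ sΓ → Σᶜ-⇛ Γ λ t σt t⊨ʳφ →
        to (truthLemma ψ t) (s⊨φ⇛ψ Γ sΓ t σt (from (truthLemma φ t) t⊨ʳφ)))
      (λ s⊨ʳφ⇛ψ Γ sΓ t (_ , closure) t⊨φ →
        from (truthLemma ψ t) (closure φ ψ (Any.singleton⁻ s⊨ʳφ⇛ψ Γ sΓ) (to (truthLemma φ t) t⊨φ)))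

    ∈⇔extensions⊨ : ∀ {S χ} → IsPrimeTheory S → (χ ∈ᶜ S) ⇔ (_⊨_ M (extensions S) χ)
    ∈⇔extensions⊨ {S} {χ} S-prime = mk⇔
      (λ χ∈S → from (truthLemma χ (extensions S)) (to (∈⇔extensions⊨ʳ S-prime) χ∈S))
      (λ S⊨χ → from (∈⇔extensions⊨ʳ S-prime) (to (truthLemma χ (extensions S)) S⊨χ))

    canonical-downMono : Λ downMono ≡ true → FrameCond M downMono
    canonical-downMono on Γ s t t≠∅ t⊆s σs = t≠∅ , λ φ ψ φ⇛ψ∈ t⊨φ →
      ⊨ʳ-⇒⁻ {φ = φ} {ψ = ψ} (⊞-⊨ʳ Γ (Λ-axiom-mp Γ on (ax-downMono φ ψ) φ⇛ψ∈) σs) t⊆s t⊨φ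

    canonical-unionClosed : Λ unionClosed ≡ true → FrameCond M unionClosed
    canonical-unionClosed on Γ s t ((v , sv) , s-closure) (_ , t-closure) = (v , inj₁ sv) , closure
      where
      both : ∀ {a b} → Declarative a → (s ∪ t) ⊫ a → a ⇛ b ∈ʷ Γ → (s ∪ t) ⊫ b
      both {a} {b} da s∪t⊫a a⇛b∈ Δ (inj₁ sΔ) =
        ⊨ʳ⇒⊫ (s-closure a b a⇛b∈ (⊫⇒⊨ʳ da λ Δ′ sΔ′ → s∪t⊫a Δ′ (inj₁ sΔ′))) Δ sΔ
      both {a} {b} da s∪t⊫a a⇛b∈ Δ (inj₂ tΔ) =
        ⊨ʳ⇒⊫ (t-closure a b a⇛b∈ (⊫⇒⊨ʳ da λ Δ′ tΔ′ → s∪t⊫a Δ′ (inj₂ tΔ′))) Δ tΔ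
      closure : ∀ φ ψ → φ ⇛ ψ ∈ʷ Γ → (s ∪ t) ⊨ʳ φ → (s ∪ t) ⊨ʳ ψ
      closure φ ψ φ⇛ψ∈ s∪t⊨φ =
        let a , a∈ , s∪t⊫a = find s∪t⊨φ
            da = All.lookup (resolutions-declarative φ) a∈
        in Any.map (both da s∪t⊫a)
                   (unionClosed-choice on Γ da _ (resolutions-nonempty ψ) (resolution-⇛-⋁ Γ φ⇛ψ∈ a∈))

    -- A maximal filter of conditional consequences of ⊤ that stays inside Γ (possible by ⊞-elim-∈ʷ)
    -- yields a neighbourhood of Γ containing Γ.
    canonical-reflexive : Λ reflexive ≡ true → FrameCond M reflexive
    canonical-reflexive on Γ = extensions carrier , primeConditionalFilter-Σᶜ Γ (isFilter , isPrime) ⊥∉ , carrier⊆Γ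
      where
      open Conditional Γ using (MaximalFilter; maximalFilter; maximalFilter-isPrime; ↑_; ↑-isFilter)
      ∉Γ : Form P → Set
      ∉Γ φ = φ ∉ᶜ proj₁ Γ
      F : MaximalFilter (↑ ⊤f) ∉Γ
      F = maximalFilter (↑ ⊤f) ∉Γ record
        { isFilter = ↑-isFilter ⊤f
        ; extends  = λ _ φ∈ → φ∈
        ; avoids   = λ φ∈ φ∉Γ → φ∉Γ (⊞-elim-∈ʷ on Γ (∈-comprehension⁻ (λ x → ⊤f ⇛ x ∈ʷ Γ) φ∈))
        }
      open MaximalFilter F
      isPrime : Conditional.IsPrime Γ carrier
      isPrime = maximalFilter-isPrime F λ φ∉ ψ∉ φ⩒ψ∈ → Sum.[ φ∉ , ψ∉ ] (IsWorld.isPrime (proj₂ Γ) φ⩒ψ∈)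
      carrier⊆Γ : carrier ⊆ᶜ proj₁ Γ
      carrier⊆Γ φ φ∈ = ∈ᶜ-stable (proj₁ Γ) (avoids φ∈)
      ⊥∉ : ⊥f ∉ᶜ carrier
      ⊥∉ ⊥∈ = IsWorld.consistent (proj₂ Γ) (carrier⊆Γ ⊥f ⊥∈)

    canonical-nonTrivial : Λ nonTrivial ≡ true → FrameCond M nonTrivial
    canonical-nonTrivial on Γ =
      let t , σt , _ = ⇛-counterexample Γ (¬-∈ʷ Γ (⊢∈ (world-theory Γ) (ax-Λ nonTrivial _ on ax-nonTrivial)))
      in t , σt

    canonical-decreasing : Λ decreasing ≡ true → FrameCond M decreasing
    canonical-decreasing on Γ Δ (u , σu , uΔ) t (t≠∅ , t-closure) = t≠∅ , λ φ ψ φ⇛ψ∈Γ →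
      t-closure φ ψ (⊨ʳ⇒⊫ (⊞-⊨ʳ Γ (Λ-axiom-mp Γ on (ax-decreasing φ ψ) φ⇛ψ∈Γ) σu) Δ uΔ)

    canonical-increasing : Λ increasing ≡ true → FrameCond M increasing
    canonical-increasing on Γ Δ (u , σu , uΔ) t (t≠∅ , t-closure) = t≠∅ , closure
      where
      closure : ∀ φ ψ → φ ⇛ ψ ∈ʷ Δ → t ⊨ʳ φ → t ⊨ʳ ψ
      closure φ ψ φ⇛ψ∈Δ with IsWorld.decides (proj₂ Γ) (d-⇛ φ ψ)
      ... | inj₁ φ⇛ψ∈Γ = t-closure φ ψ φ⇛ψ∈Γ
      ... | inj₂ ¬φ⇛ψ∈Γ =
        ⊥-elim (¬-∈ʷ Δ (⊨ʳ⇒⊫ (⊞-⊨ʳ Γ (Λ-axiom-mp Γ on (ax-increasing φ ψ) ¬φ⇛ψ∈Γ) σu) Δ uΔ) φ⇛ψ∈Δ)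

    canonical-frameSat : FrameSat Λ M
    canonical-frameSat downMono    = canonical-downMono
    canonical-frameSat unionClosed = canonical-unionClosed
    canonical-frameSat reflexive   = canonical-reflexive
    canonical-frameSat nonTrivial  = canonical-nonTrivial
    canonical-frameSat decreasing  = canonical-decreasing
    canonical-frameSat increasing  = canonical-increasing

module Completeness (lem : ExcludedMiddleω) (zorn : Zornω) {P : Set} (Λ : CondSet) where
  open Classical lem
  open Deduction {P} Λ
  open Theories lem zorn {P} Λ
  open CanonicalModel lem zorn {P} Λ
  open Equivalence using (to; from)

  ⊢-conj-⋀ : ∀ φ φs → ⊢ conj φ φs ⇒ ⋀ (φ ∷ φs)
  ⊢-conj-⋀ φ []       = deduction ⟨ axiom ⊢⊤ , #0 ⟩
  ⊢-conj-⋀ φ (χ ∷ χs) = deduction ⟨ by (⊢-conj-⋀ χ χs) (π₂ #0) , π₁ #0 ⟩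

  ⊩⇒derivFrom : ∀ {φs ψ} → φs ⊩ ψ → DerivFrom Λ φs ψ
  ⊩⇒derivFrom {[]}     ⊩ψ = closed ⊩ψ
  ⊩⇒derivFrom {φ ∷ φs} ⊩ψ = ⊢-trans (⊢-conj-⋀ φ φs) ⊩ψ

  FromPremises : (Form P → Set) → Form P → Set
  FromPremises Φ ψ = ∃ λ φs → All Φ φs × φs ⊩ ψ

  consequences : (Form P → Set) → FormSet
  consequences Φ = ｛ ψ ∣ FromPremises Φ ψ ｝

  consequences-isTheory : ∀ Φ → IsTheory (consequences Φ)
  consequences-isTheory Φ = record
    { ⊤∈       = ∈-comprehension⁺ Q ([] , [] , axiom ⊢⊤)
    ; ⊓-closed = λ φ∈ ψ∈ → ∈-comprehension⁺ Q (conjoin (∈-comprehension⁻ Q φ∈) (∈-comprehension⁻ Q ψ∈))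
    ; ≤-closed = λ ⊢φψ φ∈ → let φs , Φφs , φs⊩φ = ∈-comprehension⁻ Q φ∈
                            in ∈-comprehension⁺ Q (φs , Φφs , by ⊢φψ φs⊩φ)
    }
    where
    Q : Form P → Set
    Q = FromPremises Φ
    conjoin : ∀ {φ ψ} → Q φ → Q ψ → Q (φ ∧ ψ)
    conjoin (φs , Φφs , φs⊩φ) (ψs , Φψs , ψs⊩ψ) =
      φs ++ ψs , All.++⁺ Φφs Φψs , ⟨ ⊩-weaken ∈-++⁺ˡ φs⊩φ , ⊩-weaken (∈-++⁺ʳ φs) ψs⊩ψ ⟩

  premise-∈ : ∀ {Φ φ} → Φ φ → φ ∈ᶜ consequences Φ
  premise-∈ {Φ} {φ} Φφ = ∈-comprehension⁺ (FromPremises Φ) (φ ∷ [] , Φφ ∷ [] , #0)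

  -- The state of a prime theory that contains the consequences of Φ but not ψ.
  countermodel : ∀ {Φ ψ} → ¬ (Φ ⊢[ Λ ] ψ) →
                 Σ World λ Γ₀ → Σ (Pred World) λ s →
                   (∀ φ → Φ φ → _⊨_ (canonicalModel Γ₀) s φ) × ¬ (_⊨_ (canonicalModel Γ₀) s ψ)
  countermodel {Φ} {ψ} Φ⊬ψ =
    let Δ , Δ-prime , Φ⊆Δ , ψ∉Δ = primeTheoryTheorem (consequences-isTheory Φ) ψ∉consequences
        Γ₀ , Γ₀-world , _ =
          worldExtension (proj₁ Δ-prime) d-⊥ λ ⊥∈Δ → ψ∉Δ (IsFilter.≤-closed (proj₁ Δ-prime) (ax-EFQ ψ) ⊥∈Δ)
    in (Γ₀ , Γ₀-world) , extensions Δ ,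
       (λ φ Φφ → to (∈⇔extensions⊨ Δ-prime) (Φ⊆Δ φ (premise-∈ Φφ))) ,
       λ Δ⊨ψ → ψ∉Δ (from (∈⇔extensions⊨ Δ-prime) Δ⊨ψ)
    where
    ψ∉consequences : ψ ∉ᶜ consequences Φ
    ψ∉consequences ψ∈ = let φs , Φφs , φs⊩ψ = ∈-comprehension⁻ (FromPremises Φ) ψ∈
                        in Φ⊬ψ (φs , Φφs , ⊩⇒derivFrom φs⊩ψ)

  completeness : (Φ : Form P → Set) (ψ : Form P) → Consequence Φ Λ ψ → Φ ⊢[ Λ ] ψ
  completeness Φ ψ Φ⊨ψ with lem {A = Φ ⊢[ Λ ] ψ}
  ... | inj₁ Φ⊢ψ = Φ⊢ψ
  ... | inj₂ Φ⊬ψ =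
    let Γ₀ , s , s⊨Φ , s⊭ψ = countermodel Φ⊬ψ
    in ⊥-elim (s⊭ψ (Φ⊨ψ lzero (canonicalModel Γ₀) canonical-frameSat s s⊨Φ))

theorem7p1 : ExcludedMiddleω → Zornω →
    (P : Set) (Λ : CondSet) (Φ : Form P → Set) (ψ : Form P) →
    (Φ ⊢[ Λ ] ψ) ⇔ω Consequence Φ Λ ψ
theorem7p1 lem zorn P Λ Φ ψ = record
  { to   = soundness lem Λ Φ ψ
  ; from = Completeness.completeness lem zorn Λ Φ ψ
  }
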